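{- Let $m>n\ge 0$ be integers and $\lambda$ a partition inside the $n\times m$ board, with conjugate partition $\lambda'$ ($\lambda'_j$ is the length of column $j$, $0$ if $j>\lambda_1$). For $1\le j\le m$ let $\lambda^{c}_j$ be the partition obtained from $\lambda$ by removing its $j$th column (inside the $n\times(m-1)$ board). Then for every $k$, \[ \sum_{j=1}^m q^{m+n-j-\lambda'_j}\,H^{m-1,n}_k(\lambda^{c}_j)=[m-n]\,q^{n-k}\,H^{m,n}_k(\lambda). \]
   Context: $q$ is an indeterminate; $[x]=(1-q^x)/(1-q)$, $[n]_k=[n][n-1]\cdots[n-k+1]$ ($[n]_0=1$), $[n]!=[n]_n$, $(a;q)_k=\prod_{i=0}^{k-1}(1-aq^i)$. A partition $\lambda$ is identified with its Ferrers board (rows from the top, columns from the left, row $i$ having $\lambda_i$ cells); $|\lambda|$ is its number of cells; $\lambda$ is inside the $n\times m$ board if $\ell(\lambda)\le n$, $\lambda_1\le m$. $R_k(\lambda)=\sum_p q^{\mathrm{inv}(p)}$ over placements of $k$ non-attacking rooks on $\lambda$, with $\mathrm{inv}(p)$ the number of cells of $\lambda$ having no rook and neither to the left of a rook in the same row nor above a rook in the same column. For $m\ge n$ and $\lambda$ inside the $n\times m$ board, $H^{m,n}_i(\lambda)$ ($0\le i\le n$) are defined by $\sum_{i=0}^n H^{m,n}_i(\lambda)x^i=\frac{q^{ -|\lambda|}}{[m-n]!}\sum_{i=0}^n R_i(\lambda)[m-i]!(-1)^iq^{mi-\binom i2}(x;q)_i$, and $H^{m,n}_i(\lambda)=0$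 for $i<0$ or $i>n$. -}

module Defs where

open import Data.Nat as ℕ using (ℕ; zero; suc; _∸_; _≤ᵇ_; _≡ᵇ_; _<ᵇ_; _≤?_)
open import Data.Integer as ℤ using (ℤ; +_; -[1+_])
open import Data.Bool using (Bool; true; false; if_then_else_; _∧_; _∨_; not)
open import Data.Maybe using (Maybe; just; nothing)
open import Data.List using (List; []; _∷_; map; concatMap; foldr; filterᵇ; length; upTo; replicate; _++_)
open import Data.Vec as Vec using (Vec; toList; lookup)
open import Data.Fin using (Fin)
import Data.Fin as Fin
open import Relation.Binary.PropositionalEquality using (_≡_)
open import Relation.Nullary using (yes; no)
open import Data.Product using (_×_)

-- ℤ[q] : polynomials in the indeterminate q with integer coefficients,
-- as coefficient lists (constant term first).

Poly : Set
Poly = List ℤ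

0P : Poly
0P = []

1P : Poly
1P = + 1 ∷ []

infixl 6 _+P_
infixl 7 _*P_

_+P_ : Poly → Poly → Poly
[] +P r = r
(a ∷ p) +P [] = a ∷ p
(a ∷ p) +P (b ∷ r) = (a ℤ.+ b) ∷ (p +P r)

scaleP : ℤ → Poly → Poly
scaleP a = map (a ℤ.*_)

negP : Poly → Poly
negP = scaleP (ℤ.- (+ 1))

_*P_ : Poly → Poly → Poly
[] *P r = []
(a ∷ p) *P r = scaleP a r +P (+ 0 ∷ (p *P r))

qP^ : ℕ → Poly
qP^ e = replicate e (+ 0) ++ (+ 1 ∷ [])

coeffP : Poly → ℕ → ℤ
coeffP [] _ = + 0
coeffP (a ∷ p) zero = a
coeffP (a ∷ p) (suc i) = coeffP p i

_≈P_ : Poly → Poly → Set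
p ≈P r = ∀ i → coeffP p i ≡ coeffP r i

sumP : List Poly → Poly
sumP = foldr _+P_ 0P

-- [x] = 1 + q + ... + q^(x-1) = (1 - q^x)/(1 - q)
qint : ℕ → Poly
qint x = replicate x (+ 1)

qfact : ℕ → Poly
qfact zero = 1P
qfact (suc x) = qint (suc x) *P qfact x

signP : ℕ → Poly
signP zero = 1P
signP (suc i) = negP (signP i)

choose2 : ℕ → ℕ
choose2 zero = 0
choose2 (suc i) = i ℕ.+ choose2 i

PolyX : Set
PolyX = List Poly

_+X_ : PolyX → PolyX → PolyX
[] +X r = r
(a ∷ p) +X [] = a ∷ p
(a ∷ p) +X (b ∷ r) = (a +P b) ∷ (p +X r)

scaleX : Poly → PolyX → PolyX
scaleX c = map (c *P_)

_*X_ : PolyX → PolyX → PolyX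
[] *X r = []
(a ∷ p) *X r = scaleX a r +X (0P ∷ (p *X r))

coeffX : PolyX → ℕ → Poly
coeffX [] _ = 0P
coeffX (a ∷ p) zero = a
coeffX (a ∷ p) (suc i) = coeffX p i

sumX : List PolyX → PolyX
sumX = foldr _+X_ []

poch : ℕ → PolyX
poch zero = 1P ∷ []
poch (suc i) = poch i *X (1P ∷ negP (qP^ i) ∷ [])

-- ℚ(q) : field of fractions of ℤ[q].  A fraction num/den; all
-- denominators built below are products of powers of q and q-factorials,
-- hence nonzero.  Equality is by cross-multiplication.

record Frac : Set where
  constructor _/_
  field
    num : Poly
    den : Poly
open Frac public

_≈F_ : Frac → Frac → Set
a ≈F b = (num a *P den b) ≈P (num b *P den a)

infixl 6 _+F_
infixl 7 _*F_

_+F_ : Frac → Frac → Frac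
a +F b = (num a *P den b +P num b *P den a) / (den a *P den b)

_*F_ : Frac → Frac → Frac
a *F b = (num a *P num b) / (den a *P den b)

fromP : Poly → Frac
fromP p = p / 1P

0F : Frac
0F = fromP 0P

sumF : List Frac → Frac
sumF = foldr _+F_ 0F

qF^ : ℤ → Frac
qF^ (+ e) = qP^ e / 1P
qF^ -[1+ e ] = 1P / qP^ (suc e)

-- Partitions inside the n × m board: a vector of n row lengths
-- (row 1 = top), weakly decreasing, each ≤ m (zeros allowed, so ℓ(λ) ≤ n).

IsPartitionIn : (n m : ℕ) → Vec ℕ n → Set
IsPartitionIn n m lam =
  (∀ (i j : Fin n) → i Fin.≤ j → lookup lam j ℕ.≤ lookup lam i)
  × (∀ (i : Fin n) → lookup lam i ℕ.≤ m)

size : ∀ {n} → Vec ℕ n → ℕ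
size lam = foldr ℕ._+_ 0 (toList lam)

conj : ∀ {n} → Vec ℕ n → ℕ → ℕ
conj lam j = length (filterᵇ (λ l → j ≤ᵇ l) (toList lam))

removeCol : ∀ {n} → ℕ → Vec ℕ n → Vec ℕ n
removeCol j = Vec.map (λ l → if j ≤ᵇ l then l ∸ 1 else l)

-- Rook placements.  A placement of non-attacking rooks is encoded by a
-- list giving, for each row (top to bottom), either no rook or the column
-- (1-based) of the unique rook in that row.

assignments : List ℕ → List (List (Maybe ℕ))
assignments [] = [] ∷ []
assignments (l ∷ ls) =
  concatMap (λ rest → (nothing ∷ rest) ∷ map (λ c → just (suc c) ∷ rest) (upTo l))
            (assignments ls)

colOccurs : ℕ → List (Maybe ℕ) → Bool
colOccurs c [] = false
colOccurs c (nothing ∷ p) = colOccurs c p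
colOccurs c (just d ∷ p) = (c ≡ᵇ d) ∨ colOccurs c p

nonAttacking : List (Maybe ℕ) → Bool
nonAttacking [] = true
nonAttacking (nothing ∷ p) = nonAttacking p
nonAttacking (just c ∷ p) = not (colOccurs c p) ∧ nonAttacking p

rookCount : List (Maybe ℕ) → ℕ
rookCount [] = 0
rookCount (nothing ∷ p) = rookCount p
rookCount (just _ ∷ p) = suc (rookCount p)

cellCounts : Maybe ℕ → List (Maybe ℕ) → ℕ → Bool
cellCounts nothing  below c = not (colOccurs c below)
cellCounts (just d) below c =
  not (c ≡ᵇ d) ∧ not (c <ᵇ d) ∧ not (colOccurs c below)

inv : List ℕ → List (Maybe ℕ) → ℕ
inv (l ∷ ls) (r ∷ p) =
  length (filterᵇ (λ c → cellCounts r p (suc c)) (upTo l)) ℕ.+ inv ls p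
inv _ _ = 0

rookPoly : ∀ {n} → ℕ → Vec ℕ n → Poly
rookPoly k lam =
  sumP (map (λ p → qP^ (inv (toList lam) p))
            (filterᵇ (λ p → nonAttacking p ∧ (rookCount p ≡ᵇ k))
                     (assignments (toList lam))))

-- Σ_{i=0}^n R_i(λ)[m-i]!(-1)^i q^{mi - C(i,2)} (x;q)_i   (in ℤ[q][x];
-- the exponent mi - C(i,2) is ≥ 0 for i ≤ n ≤ m, so ∸ is exact)
HSum : (m n : ℕ) → Vec ℕ n → PolyX
HSum m n lam =
  sumX (map (λ i → scaleX (rookPoly i lam *P qfact (m ∸ i) *P signP i
                            *P qP^ (m ℕ.* i ∸ choose2 i))
                          (poch i))
            (upTo (suc n)))

H : (m n : ℕ) → Vec ℕ n → ℤ → Frac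
H m n lam -[1+ _ ] = 0F
H m n lam (+ i) with i ≤? n
... | yes _ = coeffX (HSum m n lam) i / (qP^ (size lam) *P qfact (m ∸ n))
... | no _ = 0F

-- Adding a top row of length l ≥ μ₁ to a partition μ gives the rook recursion
-- R_k(l ∷ μ) = q^(l-k) R_k(μ) + [l-k+1] R_(k-1)(μ). Induction on the rows then shows, for λ
-- inside width m, that Σ_j q^(m-j) R_k(λ^c_j) = [m-k] R_k(λ) - q^(m-k-1) (q^(k+1) - 1) R_(k+1)(λ).
-- Multiplied by [m-1-k]! (-1)^k q^((m-1)k - C(k,2)) (x;q)_k and summed over k, this says that
-- the numerators N of H^{m-1,n}(λ^c_j) and H^{m,n}(λ) satisfy Σ_j q^(m-j) N(λ^c_j)(qx) = N(λ)(x),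
-- because q^(k+1) (x;q)_(k+1) = (q^(k+1) - 1) (qx;q)_k + (qx;q)_(k+1) makes the sum telescope.
-- Taking the coefficient of x^k and using |λ^c_j| = |λ| - λ'_j gives the theorem.

module Submission where

open import Defs
open import Data.Nat using (ℕ; suc; _<_; _∸_; _≤_)
open import Data.Integer using (ℤ; +_; _-_)
open import Data.List using (map; upTo)
open import Data.Vec using (Vec)

open import Algebra.Bundles using (CommutativeRing)
open import Data.Maybe using (Maybe; just; nothing)
import Relation.Binary.PropositionalEquality as Eq
import Relation.Binary.Reasoning.Setoid as SetoidR
open import Relation.Binary.Bundles using (Setoid)
open import Tactic.RingSolver.Core.AlmostCommutativeRing using (fromCommutativeRing)
import Tactic.RingSolver.NonReflective as NonReflective

-- Instantiated as ℤ[q] and as ℤ[q][x], so that the ring solver applies to both.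
module Polynomial {c ℓ} (R : CommutativeRing c ℓ) (0≈? : ∀ x → Maybe (CommutativeRing._≈_ R (CommutativeRing.0# R) x)) where

  open import Data.Nat using (zero)
  open import Data.Nat.Properties using (m<n⇒m<1+n; n<1+n)
  open import Data.List using (List; []; _∷_)
  open import Data.Product using (_,_)
  open CommutativeRing R hiding (zero)
  open import Algebra.Properties.CommutativeSemigroup +-commutativeSemigroup using (interchange)
  open import Algebra.Properties.Ring ring using (-0#≈0#)

  -- Coefficient lists, constant term first; trailing zeros are allowed, so
  -- equality is coefficientwise.
  Pol : Set c
  Pol = List Carrier

  infixl 6 _⊕_
  infixl 7 _⊗_
  infix 4 _≋_

  _⊕_ : Pol → Pol → Pol
  [] ⊕ r = r
  (a ∷ p) ⊕ [] = a ∷ p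
  (a ∷ p) ⊕ (b ∷ r) = (a + b) ∷ (p ⊕ r)

  scale : Carrier → Pol → Pol
  scale a = map (a *_)

  _⊗_ : Pol → Pol → Pol
  [] ⊗ r = []
  (a ∷ p) ⊗ r = scale a r ⊕ (0# ∷ (p ⊗ r))

  ⊝ : Pol → Pol
  ⊝ = map (-_)

  coeff : Pol → ℕ → Carrier
  coeff [] _ = 0#
  coeff (a ∷ p) zero = a
  coeff (a ∷ p) (suc i) = coeff p i

  record _≋_ (p r : Pol) : Set ℓ where
    constructor mk≋
    field get : ∀ i → coeff p i ≈ coeff r i
  open _≋_ public

  ≋-refl : ∀ {p} → p ≋ p
  ≋-refl = mk≋ λ i → refl
  ≋-sym : ∀ {p r} → p ≋ r → r ≋ p
  ≋-sym e = mk≋ λ i → sym (get e i)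
  ≋-trans : ∀ {p r s} → p ≋ r → r ≋ s → p ≋ s
  ≋-trans e f = mk≋ λ i → trans (get e i) (get f i)

  ≋-reflexive : ∀ {p r} → p Eq.≡ r → p ≋ r
  ≋-reflexive Eq.refl = ≋-refl

  ≋-setoid : Setoid c ℓ
  ≋-setoid = record { Carrier = Pol ; _≈_ = _≋_ ; isEquivalence = record { refl = ≋-refl ; sym = ≋-sym ; trans = ≋-trans } }

  open SetoidR setoid

  coeff-⊕ : ∀ p r i → coeff (p ⊕ r) i ≈ coeff p i + coeff r i
  coeff-⊕ [] r i = sym (+-identityˡ _)
  coeff-⊕ (a ∷ p) [] zero = sym (+-identityʳ _)
  coeff-⊕ (a ∷ p) [] (suc i) = sym (+-identityʳ _)
  coeff-⊕ (a ∷ p) (b ∷ r) zero = refl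
  coeff-⊕ (a ∷ p) (b ∷ r) (suc i) = coeff-⊕ p r i

  coeff-scale : ∀ a p i → coeff (scale a p) i ≈ a * coeff p i
  coeff-scale a [] i = sym (zeroʳ a)
  coeff-scale a (b ∷ p) zero = refl
  coeff-scale a (b ∷ p) (suc i) = coeff-scale a p i

  coeff-⊝ : ∀ p i → coeff (⊝ p) i ≈ - coeff p i
  coeff-⊝ [] i = sym -0#≈0#
  coeff-⊝ (b ∷ p) zero = refl
  coeff-⊝ (b ∷ p) (suc i) = coeff-⊝ p i

  cons-cong : ∀ {a b p r} → a ≈ b → p ≋ r → (a ∷ p) ≋ (b ∷ r)
  cons-cong e f = mk≋ λ { zero → e ; (suc i) → get f i }

  ≋[]-head : ∀ {a p} → (a ∷ p) ≋ [] → a ≈ 0#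
  ≋[]-head e = get e zero
  ≋[]-tail : ∀ {a p} → (a ∷ p) ≋ [] → p ≋ []
  ≋[]-tail e = mk≋ λ i → get e (suc i)
  tail-cong : ∀ {a b p r} → (a ∷ p) ≋ (b ∷ r) → p ≋ r
  tail-cong e = mk≋ λ i → get e (suc i)

  0∷[] : (0# ∷ []) ≋ []
  0∷[] = mk≋ λ { zero → refl ; (suc i) → refl }

  ⊕-cong : ∀ {p p' r r'} → p ≋ p' → r ≋ r' → p ⊕ r ≋ p' ⊕ r'
  ⊕-cong {p} {p'} {r} {r'} e f = mk≋ λ i → begin
    coeff (p ⊕ r) i ≈⟨ coeff-⊕ p r i ⟩ coeff p i + coeff r i ≈⟨ +-cong (get e i) (get f i) ⟩
    coeff p' i + coeff r' i ≈⟨ sym (coeff-⊕ p' r' i) ⟩ coeff (p' ⊕ r') i ∎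

  scale-cong : ∀ {a b p r} → a ≈ b → p ≋ r → scale a p ≋ scale b r
  scale-cong {a} {b} {p} {r} e f = mk≋ λ i → begin
    coeff (scale a p) i ≈⟨ coeff-scale a p i ⟩ a * coeff p i ≈⟨ *-cong e (get f i) ⟩
    b * coeff r i ≈⟨ sym (coeff-scale b r i) ⟩ coeff (scale b r) i ∎

  ⊝-cong : ∀ {p r} → p ≋ r → ⊝ p ≋ ⊝ r
  ⊝-cong {p} {r} e = mk≋ λ i → begin
    coeff (⊝ p) i ≈⟨ coeff-⊝ p i ⟩ - coeff p i ≈⟨ -‿cong (get e i) ⟩
    - coeff r i ≈⟨ sym (coeff-⊝ r i) ⟩ coeff (⊝ r) i ∎

  ⊕-comm : ∀ p r → p ⊕ r ≋ r ⊕ p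
  ⊕-comm p r = mk≋ λ i → begin
    coeff (p ⊕ r) i ≈⟨ coeff-⊕ p r i ⟩ coeff p i + coeff r i ≈⟨ +-comm _ _ ⟩
    coeff r i + coeff p i ≈⟨ sym (coeff-⊕ r p i) ⟩ coeff (r ⊕ p) i ∎

  ⊕-assoc : ∀ p r s → (p ⊕ r) ⊕ s ≋ p ⊕ (r ⊕ s)
  ⊕-assoc p r s = mk≋ λ i → begin
    coeff ((p ⊕ r) ⊕ s) i ≈⟨ coeff-⊕ (p ⊕ r) s i ⟩
    coeff (p ⊕ r) i + coeff s i ≈⟨ +-congʳ (coeff-⊕ p r i) ⟩
    (coeff p i + coeff r i) + coeff s i ≈⟨ +-assoc _ _ _ ⟩
    coeff p i + (coeff r i + coeff s i) ≈⟨ +-congˡ (sym (coeff-⊕ r s i)) ⟩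
    coeff p i + coeff (r ⊕ s) i ≈⟨ sym (coeff-⊕ p (r ⊕ s) i) ⟩
    coeff (p ⊕ (r ⊕ s)) i ∎

  ⊕-identityʳ : ∀ p → p ⊕ [] ≋ p
  ⊕-identityʳ [] = ≋-refl
  ⊕-identityʳ (a ∷ p) = ≋-refl

  ⊝-inverseʳ : ∀ p → p ⊕ ⊝ p ≋ []
  ⊝-inverseʳ p = mk≋ λ i → begin
    coeff (p ⊕ ⊝ p) i ≈⟨ coeff-⊕ p (⊝ p) i ⟩ coeff p i + coeff (⊝ p) i ≈⟨ +-congˡ (coeff-⊝ p i) ⟩
    coeff p i + - coeff p i ≈⟨ -‿inverseʳ _ ⟩ 0# ∎

  ⊝-inverseˡ : ∀ p → ⊝ p ⊕ p ≋ []
  ⊝-inverseˡ p = ≋-trans (⊕-comm (⊝ p) p) (⊝-inverseʳ p)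

  scale-⊕ : ∀ a p r → scale a (p ⊕ r) ≋ scale a p ⊕ scale a r
  scale-⊕ a p r = mk≋ λ i → begin
    coeff (scale a (p ⊕ r)) i ≈⟨ coeff-scale a (p ⊕ r) i ⟩ a * coeff (p ⊕ r) i ≈⟨ *-congˡ (coeff-⊕ p r i) ⟩
    a * (coeff p i + coeff r i) ≈⟨ distribˡ _ _ _ ⟩ a * coeff p i + a * coeff r i
      ≈⟨ +-cong (sym (coeff-scale a p i)) (sym (coeff-scale a r i)) ⟩
    coeff (scale a p) i + coeff (scale a r) i ≈⟨ sym (coeff-⊕ (scale a p) (scale a r) i) ⟩ coeff (scale a p ⊕ scale a r) i ∎

  scale-+ : ∀ a b p → scale (a + b) p ≋ scale a p ⊕ scale b p
  scale-+ a b p = mk≋ λ i → begin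
    coeff (scale (a + b) p) i ≈⟨ coeff-scale (a + b) p i ⟩ (a + b) * coeff p i ≈⟨ distribʳ _ _ _ ⟩
    a * coeff p i + b * coeff p i ≈⟨ +-cong (sym (coeff-scale a p i)) (sym (coeff-scale b p i)) ⟩
    coeff (scale a p) i + coeff (scale b p) i ≈⟨ sym (coeff-⊕ (scale a p) (scale b p) i) ⟩ coeff (scale a p ⊕ scale b p) i ∎

  scale-scale : ∀ a b p → scale a (scale b p) ≋ scale (a * b) p
  scale-scale a b p = mk≋ λ i → begin
    coeff (scale a (scale b p)) i ≈⟨ coeff-scale a (scale b p) i ⟩ a * coeff (scale b p) i ≈⟨ *-congˡ (coeff-scale b p i) ⟩
    a * (b * coeff p i) ≈⟨ sym (*-assoc _ _ _) ⟩ (a * b) * coeff p i ≈⟨ sym (coeff-scale (a * b) p i) ⟩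
    coeff (scale (a * b) p) i ∎

  scale-0 : ∀ p → scale 0# p ≋ []
  scale-0 p = mk≋ λ i → begin coeff (scale 0# p) i ≈⟨ coeff-scale 0# p i ⟩ 0# * coeff p i ≈⟨ zeroˡ _ ⟩ 0# ∎

  scale-1 : ∀ p → scale 1# p ≋ p
  scale-1 p = mk≋ λ i → begin coeff (scale 1# p) i ≈⟨ coeff-scale 1# p i ⟩ 1# * coeff p i ≈⟨ *-identityˡ _ ⟩ coeff p i ∎

  0∷⊕ : ∀ p r → (0# ∷ p) ⊕ (0# ∷ r) ≋ 0# ∷ (p ⊕ r)
  0∷⊕ p r = cons-cong (+-identityˡ _) ≋-refl

  ⊕-interchange : ∀ a b c d → (a ⊕ b) ⊕ (c ⊕ d) ≋ (a ⊕ c) ⊕ (b ⊕ d)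
  ⊕-interchange a b c d = mk≋ λ i → begin
    coeff ((a ⊕ b) ⊕ (c ⊕ d)) i ≈⟨ coeff-⊕ (a ⊕ b) (c ⊕ d) i ⟩
    coeff (a ⊕ b) i + coeff (c ⊕ d) i ≈⟨ +-cong (coeff-⊕ a b i) (coeff-⊕ c d i) ⟩
    (coeff a i + coeff b i) + (coeff c i + coeff d i) ≈⟨ interchange (coeff a i) (coeff b i) (coeff c i) (coeff d i) ⟩
    (coeff a i + coeff c i) + (coeff b i + coeff d i) ≈⟨ sym (+-cong (coeff-⊕ a c i) (coeff-⊕ b d i)) ⟩
    coeff (a ⊕ c) i + coeff (b ⊕ d) i ≈⟨ sym (coeff-⊕ (a ⊕ c) (b ⊕ d) i) ⟩
    coeff ((a ⊕ c) ⊕ (b ⊕ d)) i ∎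

  ⊗-[]ˡ : ∀ p r → p ≋ [] → p ⊗ r ≋ []
  ⊗-[]ˡ [] r e = ≋-refl
  ⊗-[]ˡ (a ∷ p) r e = ≋-trans (⊕-cong (≋-trans (scale-cong (≋[]-head e) ≋-refl) (scale-0 r))
                                        (cons-cong refl (⊗-[]ˡ p r (≋[]-tail e))))
                              0∷[]

  ≋-⊕[]ʳ : ∀ {p r s} → p ≋ r ⊕ s → s ≋ [] → p ≋ r
  ≋-⊕[]ʳ {r = r} e z = ≋-trans e (≋-trans (⊕-cong ≋-refl z) (⊕-identityʳ r))

  ⊗-congˡ : ∀ {p p'} r → p ≋ p' → p ⊗ r ≋ p' ⊗ r
  ⊗-congˡ {[]} {p'} r e = ≋-sym (⊗-[]ˡ p' r (≋-sym e))
  ⊗-congˡ {a ∷ p} {[]} r e = ⊗-[]ˡ (a ∷ p) r e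
  ⊗-congˡ {a ∷ p} {b ∷ p'} r e =
    ⊕-cong (scale-cong (get e zero) ≋-refl) (cons-cong refl (⊗-congˡ r (tail-cong e)))

  ⊗-congʳ : ∀ p {r r'} → r ≋ r' → p ⊗ r ≋ p ⊗ r'
  ⊗-congʳ [] e = ≋-refl
  ⊗-congʳ (a ∷ p) e = ⊕-cong (scale-cong refl e) (cons-cong refl (⊗-congʳ p e))

  ⊗-cong : ∀ {p p' r r'} → p ≋ p' → r ≋ r' → p ⊗ r ≋ p' ⊗ r'
  ⊗-cong {p} {p'} {r} {r'} e f = ≋-trans (⊗-congˡ r e) (⊗-congʳ p' f)

  ⊗-zeroʳ : ∀ p → p ⊗ [] ≋ []
  ⊗-zeroʳ [] = ≋-refl
  ⊗-zeroʳ (a ∷ p) = ≋-trans (cons-cong refl (⊗-zeroʳ p)) 0∷[]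

  ⊗-[]ʳ : ∀ p {r} → r ≋ [] → p ⊗ r ≋ []
  ⊗-[]ʳ p e = ≋-trans (⊗-congʳ p e) (⊗-zeroʳ p)

  ⊗-cons-r : ∀ p b r → p ⊗ (b ∷ r) ≋ scale b p ⊕ (0# ∷ p ⊗ r)
  ⊗-cons-r [] b r = ≋-sym 0∷[]
  ⊗-cons-r (a ∷ p) b r = cons-cong lhd ltl
    where
    lhd : a * b + 0# ≈ b * a + 0#
    lhd = +-congʳ (*-comm a b)
    ltl : scale a r ⊕ p ⊗ (b ∷ r) ≋ scale b p ⊕ (scale a r ⊕ (0# ∷ p ⊗ r))
    ltl = ≋-trans (⊕-cong ≋-refl (⊗-cons-r p b r))
          (≋-trans (≋-sym (⊕-assoc (scale a r) (scale b p) _))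
          (≋-trans (⊕-cong (⊕-comm (scale a r) (scale b p)) ≋-refl)
          (⊕-assoc (scale b p) (scale a r) _)))

  ⊗-comm : ∀ p r → p ⊗ r ≋ r ⊗ p
  ⊗-comm [] r = ≋-sym (⊗-zeroʳ r)
  ⊗-comm (a ∷ p) r = ≋-trans (⊕-cong ≋-refl (cons-cong refl (⊗-comm p r)))
                             (≋-sym (⊗-cons-r r a p))

  ⊗-distribʳ : ∀ p s r → (p ⊕ s) ⊗ r ≋ p ⊗ r ⊕ s ⊗ r
  ⊗-distribʳ [] s r = ≋-refl
  ⊗-distribʳ (a ∷ p) [] r = ≋-sym (⊕-identityʳ _)
  ⊗-distribʳ (a ∷ p) (b ∷ s) r =
    ≋-trans (⊕-cong (scale-+ a b r) (≋-trans (cons-cong refl (⊗-distribʳ p s r)) (≋-sym (0∷⊕ (p ⊗ r) (s ⊗ r)))))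
            (⊕-interchange (scale a r) (scale b r) (0# ∷ p ⊗ r) (0# ∷ s ⊗ r))

  ⊗-distribˡ : ∀ r p s → r ⊗ (p ⊕ s) ≋ r ⊗ p ⊕ r ⊗ s
  ⊗-distribˡ r p s = ≋-trans (⊗-comm r (p ⊕ s))
    (≋-trans (⊗-distribʳ p s r) (⊕-cong (⊗-comm p r) (⊗-comm s r)))

  0∷-⊗ : ∀ p r → (0# ∷ p) ⊗ r ≋ 0# ∷ (p ⊗ r)
  0∷-⊗ p r = ≋-trans (⊕-cong (scale-0 r) ≋-refl) ≋-refl

  scale-⊗ : ∀ a p r → scale a p ⊗ r ≋ scale a (p ⊗ r)
  scale-⊗ a [] r = ≋-refl
  scale-⊗ a (b ∷ p) r = ≋-trans (⊕-cong (≋-sym (scale-scale a b r)) (cons-cong (sym (zeroʳ a)) (scale-⊗ a p r)))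
                             (≋-sym (scale-⊕ a (scale b r) (0# ∷ p ⊗ r)))

  ⊗-assoc : ∀ p r s → (p ⊗ r) ⊗ s ≋ p ⊗ (r ⊗ s)
  ⊗-assoc [] r s = ≋-refl
  ⊗-assoc (a ∷ p) r s =
    ≋-trans (⊗-distribʳ (scale a r) (0# ∷ p ⊗ r) s)
      (⊕-cong (scale-⊗ a r s) (≋-trans (0∷-⊗ (p ⊗ r) s) (cons-cong refl (⊗-assoc p r s))))

  ⊗-identityˡ : ∀ r → (1# ∷ []) ⊗ r ≋ r
  ⊗-identityˡ r = ≋-trans (⊕-cong ≋-refl 0∷[]) (≋-trans (⊕-identityʳ _) (scale-1 r))

  ⊗-identityʳ : ∀ r → r ⊗ (1# ∷ []) ≋ r
  ⊗-identityʳ r = ≋-trans (⊗-comm r _) (⊗-identityˡ r)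

  ⊕-identityˡ : ∀ p → [] ⊕ p ≋ p
  ⊕-identityˡ p = ≋-refl

  commutativeRing : CommutativeRing c ℓ
  commutativeRing = record
    { Carrier = Pol ; _≈_ = _≋_ ; _+_ = _⊕_ ; _*_ = _⊗_ ; -_ = ⊝ ; 0# = [] ; 1# = 1# ∷ []
    ; isCommutativeRing = record
      { isRing = record
        { +-isAbelianGroup = record
          { isGroup = record
            { isMonoid = record
              { isSemigroup = record
                { isMagma = record { isEquivalence = Setoid.isEquivalence ≋-setoid ; ∙-cong = ⊕-cong }
                ; assoc = ⊕-assoc }
              ; identity = ⊕-identityˡ , ⊕-identityʳ }
            ; inverse = ⊝-inverseˡ , ⊝-inverseʳ
            ; ⁻¹-cong = ⊝-cong }
          ; comm = ⊕-comm }
        ; *-cong = ⊗-cong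
        ; *-assoc = ⊗-assoc
        ; *-identity = ⊗-identityˡ , ⊗-identityʳ
        ; distrib = ⊗-distribˡ , (λ x y z → ⊗-distribʳ y z x) }
      ; *-comm = ⊗-comm } }

  -- The (incomplete) zero test the ring solver needs.
  []≋? : ∀ p → Maybe ([] ≋ p)
  []≋? [] = just ≋-refl
  []≋? (a ∷ p) with 0≈? a | []≋? p
  ... | just e | just f = just (≋-trans (≋-sym 0∷[]) (cons-cong e f))
  ... | _ | _ = nothing

  X : Pol
  X = 0# ∷ 1# ∷ []

  0∷≋X⊗ : ∀ p → (0# ∷ p) ≋ X ⊗ p
  0∷≋X⊗ p = ≋-sym (≋-trans (⊕-cong (scale-0 p) (cons-cong refl (⊗-identityˡ p))) ≋-refl)

  const-⊗ : ∀ a p → (a ∷ []) ⊗ p ≋ scale a p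
  const-⊗ a p = ≋-trans (⊕-cong ≋-refl 0∷[]) (⊕-identityʳ _)

  ∷≋const+X⊗ : ∀ a p → (a ∷ p) ≋ (a ∷ []) ⊕ X ⊗ p
  ∷≋const+X⊗ a p = ≋-trans (mk≋ λ { zero → sym (+-identityʳ a) ; (suc i) → refl })
                      (⊕-cong (≋-refl {a ∷ []}) (0∷≋X⊗ p))

  ∑< : ℕ → (ℕ → Pol) → Pol
  ∑< zero f = []
  ∑< (suc n) f = ∑< n f ⊕ f n

  ∑<-cong : ∀ n {f g} → (∀ i → i < n → f i ≋ g i) → ∑< n f ≋ ∑< n g
  ∑<-cong zero e = ≋-refl
  ∑<-cong (suc n) e = ⊕-cong (∑<-cong n (λ i i<n → e i (m<n⇒m<1+n i<n))) (e n (n<1+n n))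

  ∑<-⊕ : ∀ n f g → ∑< n (λ i → f i ⊕ g i) ≋ ∑< n f ⊕ ∑< n g
  ∑<-⊕ zero f g = ≋-refl
  ∑<-⊕ (suc n) f g = ≋-trans (⊕-cong (∑<-⊕ n f g) ≋-refl) (⊕-interchange (∑< n f) (∑< n g) (f n) (g n))

  ∑<-suc : ∀ n f → ∑< (suc n) f ≋ f 0 ⊕ ∑< n (λ i → f (suc i))
  ∑<-suc zero f = ⊕-comm [] (f 0)
  ∑<-suc (suc n) f = ≋-trans (⊕-cong (∑<-suc n f) ≋-refl) (⊕-assoc (f 0) _ _)

module Coefficients where

  open import Data.Nat using (zero; suc)
  open import Data.Integer using (+_)
  open import Data.Integer.Properties using (+-*-commutativeRing)
  open import Data.List using ([]; _∷_)
  open import Relation.Binary.PropositionalEquality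

  0≡? : ∀ x → Maybe (+ 0 ≡ x)
  0≡? (+ zero) = just refl
  0≡? _ = nothing

  module ℤq = Polynomial +-*-commutativeRing 0≡?
  module ℤqx = Polynomial ℤq.commutativeRing ℤq.[]≋?

  module ℤq-Solver = NonReflective (fromCommutativeRing ℤq.commutativeRing ℤq.[]≋?)
    renaming (_⊕_ to infixl 7 _:+_; _⊗_ to infixl 8 _:*_; ⊝_ to infix 9 :-_)
  module ℤqx-Solver = NonReflective (fromCommutativeRing ℤqx.commutativeRing ℤqx.[]≋?)
    renaming (_⊕_ to infixl 7 _:+_; _⊗_ to infixl 8 _:*_; ⊝_ to infix 9 :-_)

  +P≡⊕ : ∀ p r → p +P r ≡ p ℤq.⊕ r
  +P≡⊕ [] r = refl
  +P≡⊕ (a ∷ p) [] = refl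
  +P≡⊕ (a ∷ p) (b ∷ r) = cong (_ ∷_) (+P≡⊕ p r)

  *P≡⊗ : ∀ p r → p *P r ≡ p ℤq.⊗ r
  *P≡⊗ [] r = refl
  *P≡⊗ (a ∷ p) r rewrite *P≡⊗ p r = +P≡⊕ (scaleP a r) _

  coeffP≡coeff : ∀ p i → coeffP p i ≡ ℤq.coeff p i
  coeffP≡coeff [] i = refl
  coeffP≡coeff (a ∷ p) zero = refl
  coeffP≡coeff (a ∷ p) (suc i) = coeffP≡coeff p i

  ≋⇒≈P : ∀ {p r} → p ℤq.≋ r → p ≈P r
  ≋⇒≈P {p} {r} e i = trans (coeffP≡coeff p i) (trans (ℤq.get e i) (sym (coeffP≡coeff r i)))

  +X≡⊕ : ∀ p r → p +X r ≡ p ℤqx.⊕ r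
  +X≡⊕ [] r = refl
  +X≡⊕ (a ∷ p) [] = refl
  +X≡⊕ (a ∷ p) (b ∷ r) = cong₂ _∷_ (+P≡⊕ a b) (+X≡⊕ p r)

  scaleX≡scale : ∀ c p → scaleX c p ≡ ℤqx.scale c p
  scaleX≡scale c [] = refl
  scaleX≡scale c (a ∷ p) = cong₂ _∷_ (*P≡⊗ c a) (scaleX≡scale c p)

  *X≡⊗ : ∀ p r → p *X r ≡ p ℤqx.⊗ r
  *X≡⊗ [] r = refl
  *X≡⊗ (a ∷ p) r rewrite *X≡⊗ p r | scaleX≡scale a r = +X≡⊕ (ℤqx.scale a r) _

  coeffX≡coeff : ∀ p i → coeffX p i ≡ ℤqx.coeff p i
  coeffX≡coeff [] i = refl
  coeffX≡coeff (a ∷ p) zero = refl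
  coeffX≡coeff (a ∷ p) (suc i) = coeffX≡coeff p i

module QNumbers where

  open Coefficients
  open import Data.Nat as ℕ using (ℕ; zero; suc)
  open import Data.Integer using (+_)
  open import Data.List using (_∷_)
  open ℤq using (_⊕_; _⊗_; ⊝; _≋_; ≋-refl; ≋-sym; ⊕-cong; ⊗-cong)
  open ℤq-Solver using (solve; _⊜_; _:+_; _:*_)
  open SetoidR ℤq.≋-setoid

  q : Poly
  q = ℤq.X

  q^[1+_]-1 : ℕ → Poly
  q^[1+ k ]-1 = qP^ (suc k) ⊕ ⊝ 1P

  qP^-suc : ∀ e → qP^ (suc e) ≋ q ⊗ qP^ e
  qP^-suc e = ℤq.0∷≋X⊗ (qP^ e)

  qP^-+ : ∀ a b → qP^ (a ℕ.+ b) ≋ qP^ a ⊗ qP^ b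
  qP^-+ zero b = ≋-sym (ℤq.⊗-identityˡ (qP^ b))
  qP^-+ (suc a) b = begin
    qP^ (suc (a ℕ.+ b)) ≈⟨ qP^-suc (a ℕ.+ b) ⟩
    q ⊗ qP^ (a ℕ.+ b) ≈⟨ ⊗-cong (≋-refl {q}) (qP^-+ a b) ⟩
    q ⊗ (qP^ a ⊗ qP^ b) ≈⟨ ≋-sym (ℤq.⊗-assoc q (qP^ a) (qP^ b)) ⟩
    (q ⊗ qP^ a) ⊗ qP^ b ≈⟨ ⊗-cong (≋-sym (qP^-suc a)) (≋-refl {qP^ b}) ⟩
    qP^ (suc a) ⊗ qP^ b ∎

  qint-suc : ∀ t → qint (suc t) ≋ 1P ⊕ q ⊗ qint t
  qint-suc t = ℤq.∷≋const+X⊗ (+ 1) (qint t)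

  qint-+ : ∀ a b → qint (a ℕ.+ b) ≋ qint a ⊕ qP^ a ⊗ qint b
  qint-+ zero b = ≋-sym (ℤq.⊗-identityˡ (qint b))
  qint-+ (suc a) b = begin
    qint (suc (a ℕ.+ b)) ≈⟨ qint-suc (a ℕ.+ b) ⟩
    1P ⊕ q ⊗ qint (a ℕ.+ b) ≈⟨ ⊕-cong (≋-refl {1P}) (⊗-cong (≋-refl {q}) (qint-+ a b)) ⟩
    1P ⊕ q ⊗ (qint a ⊕ qP^ a ⊗ qint b) ≈⟨ solve 5 (λ o x A Q B → o :+ x :* (A :+ Q :* B) ⊜ (o :+ x :* A) :+ (x :* Q) :* B) ≋-refl 1P q (qint a) (qP^ a) (qint b) ⟩
    (1P ⊕ q ⊗ qint a) ⊕ (q ⊗ qP^ a) ⊗ qint b ≈⟨ ⊕-cong (≋-sym (qint-suc a)) (⊗-cong (≋-sym (qP^-suc a)) (≋-refl {qint b})) ⟩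
    qint (suc a) ⊕ qP^ (suc a) ⊗ qint b ∎

module FilterCounts where

  open import Data.Nat as ℕ using (ℕ; zero; suc; _≤_; _<_; _≡ᵇ_; _<ᵇ_; s≤s)
  open import Data.Bool using (Bool; true; false; if_then_else_)
  open import Data.List using (List; []; _∷_; filterᵇ; length; _∷ʳ_)
  open import Data.List.Relation.Unary.All using (All; []; _∷_)
  import Data.List.Relation.Unary.All.Properties as AllP
  open import Relation.Binary.PropositionalEquality as Eq using (_≡_; refl)

  private
    variable
      A : Set

  filterᵇ-cons : ∀ (p : A → Bool) x xs → filterᵇ p (x ∷ xs) ≡ (if p x then x ∷ filterᵇ p xs else filterᵇ p xs)
  filterᵇ-cons p x xs with p x
  ... | true = refl
  ... | false = refl

  indicator : Bool → ℕ
  indicator b = if b then 1 else 0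

  len-filter-∷ʳ : ∀ (p : A → Bool) xs y → length (filterᵇ p (xs ∷ʳ y)) ≡ length (filterᵇ p xs) ℕ.+ indicator (p y)
  len-filter-∷ʳ p [] y with p y
  ... | true = refl
  ... | false = refl
  len-filter-∷ʳ p (x ∷ xs) y rewrite filterᵇ-cons p x (xs ∷ʳ y) | filterᵇ-cons p x xs with p x
  ... | true = Eq.cong suc (len-filter-∷ʳ p xs y)
  ... | false = len-filter-∷ʳ p xs y

  len-filter-none : ∀ {p : A → Bool} xs → All (λ x → p x ≡ false) xs → length (filterᵇ p xs) ≡ 0
  len-filter-none [] [] = refl
  len-filter-none {p = p} (x ∷ xs) (e ∷ es) rewrite filterᵇ-cons p x xs | e = len-filter-none xs es

  upTo-< : ∀ l → All (_< l) (upTo l)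
  upTo-< l = AllP.applyUpTo⁺₁ (λ i → i) l (λ i<l → i<l)

  ≡ᵇ-refl : ∀ n → (n ≡ᵇ n) ≡ true
  ≡ᵇ-refl zero = refl
  ≡ᵇ-refl (suc n) = ≡ᵇ-refl n

  <⇒≢ᵇ : ∀ {a b} → a < b → (a ≡ᵇ b) ≡ false
  <⇒≢ᵇ {zero} {suc b} _ = refl
  <⇒≢ᵇ {suc a} {suc b} (s≤s p) = <⇒≢ᵇ p

  <⇒<ᵇ≡true : ∀ {a b} → a < b → (a <ᵇ b) ≡ true
  <⇒<ᵇ≡true {zero} {suc b} _ = refl
  <⇒<ᵇ≡true {suc a} {suc b} (s≤s p) = <⇒<ᵇ≡true p

  ≥⇒≮ᵇ : ∀ {a b} → b ≤ a → (a <ᵇ b) ≡ false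
  ≥⇒≮ᵇ {a} {zero} _ = refl
  ≥⇒≮ᵇ {suc a} {suc b} (s≤s p) = ≥⇒≮ᵇ p

  ≡ᵇ-comm : ∀ a b → (a ≡ᵇ b) ≡ (b ≡ᵇ a)
  ≡ᵇ-comm zero zero = refl
  ≡ᵇ-comm zero (suc b) = refl
  ≡ᵇ-comm (suc a) zero = refl
  ≡ᵇ-comm (suc a) (suc b) = ≡ᵇ-comm a b

module ListSums where

  open Coefficients
  open FilterCounts using (filterᵇ-cons)
  open import Data.Bool using (true; false; if_then_else_)
  open import Data.List using (List; []; _∷_; filterᵇ; _++_; concatMap)
  open import Data.List.Relation.Unary.All using (All; []; _∷_)
  open import Function using (_∘_)
  open import Relation.Binary.PropositionalEquality as Eq using (_≡_; refl)
  open ℤq using (_⊕_; _⊗_; _≋_; ≋-refl; ≋-sym; ≋-trans; ⊕-cong)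

  private
    variable
      A B : Set

  ΣL : (A → Poly) → List A → Poly
  ΣL f [] = []
  ΣL f (x ∷ xs) = f x ⊕ ΣL f xs

  sumP-map : ∀ (f : A → Poly) xs → sumP (map f xs) ≡ ΣL f xs
  sumP-map f [] = refl
  sumP-map f (x ∷ xs) = Eq.trans (+P≡⊕ (f x) (sumP (map f xs))) (Eq.cong (f x ⊕_) (sumP-map f xs))

  ΣL-filter : ∀ (f : A → Poly) p xs → ΣL f (filterᵇ p xs) ≋ ΣL (λ x → if p x then f x else []) xs
  ΣL-filter f p [] = ≋-refl
  ΣL-filter f p (x ∷ xs) rewrite filterᵇ-cons p x xs with p x
  ... | true = ⊕-cong (≋-refl {f x}) (ΣL-filter f p xs)
  ... | false = ΣL-filter f p xs

  ΣL-++ : ∀ (f : A → Poly) xs ys → ΣL f (xs ++ ys) ≋ ΣL f xs ⊕ ΣL f ys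
  ΣL-++ f [] ys = ≋-refl
  ΣL-++ f (x ∷ xs) ys = ≋-trans (⊕-cong (≋-refl {f x}) (ΣL-++ f xs ys)) (≋-sym (ℤq.⊕-assoc (f x) _ _))

  ΣL-concatMap : ∀ (f : B → Poly) (g : A → List B) xs → ΣL f (concatMap g xs) ≋ ΣL (λ x → ΣL f (g x)) xs
  ΣL-concatMap f g [] = ≋-refl
  ΣL-concatMap f g (x ∷ xs) = ≋-trans (ΣL-++ f (g x) (concatMap g xs)) (⊕-cong (≋-refl {ΣL f (g x)}) (ΣL-concatMap f g xs))

  ΣL-map : ∀ (f : B → Poly) (g : A → B) xs → ΣL f (map g xs) ≡ ΣL (f ∘ g) xs
  ΣL-map f g [] = refl
  ΣL-map f g (x ∷ xs) = Eq.cong (f (g x) ⊕_) (ΣL-map f g xs)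

  ΣL-cong : ∀ {Q : A → Set} {f g : A → Poly} {xs} → All Q xs → (∀ {x} → Q x → f x ≋ g x) → ΣL f xs ≋ ΣL g xs
  ΣL-cong [] e = ≋-refl
  ΣL-cong (px ∷ pxs) e = ⊕-cong (e px) (ΣL-cong pxs e)

  ΣL-⊕ : ∀ (f g : A → Poly) xs → ΣL (λ x → f x ⊕ g x) xs ≋ ΣL f xs ⊕ ΣL g xs
  ΣL-⊕ f g [] = ≋-refl
  ΣL-⊕ f g (x ∷ xs) = ≋-trans (⊕-cong (≋-refl {f x ⊕ g x}) (ΣL-⊕ f g xs))
    (ℤq.⊕-interchange (f x) (g x) (ΣL f xs) (ΣL g xs))

  ΣL-⊗ : ∀ c (f : A → Poly) xs → ΣL (λ x → c ⊗ f x) xs ≋ c ⊗ ΣL f xs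
  ΣL-⊗ c f [] = ≋-sym (ℤq.⊗-zeroʳ c)
  ΣL-⊗ c f (x ∷ xs) = ≋-trans (⊕-cong (≋-refl {c ⊗ f x}) (ΣL-⊗ c f xs)) (≋-sym (ℤq.⊗-distribˡ c (f x) (ΣL f xs)))

  ΣL-zero : ∀ {f : A → Poly} xs → (∀ x → f x ≋ []) → ΣL f xs ≋ []
  ΣL-zero [] e = ≋-refl
  ΣL-zero (x ∷ xs) e = ⊕-cong (e x) (ΣL-zero xs e)

module RookNumbers where

  open Coefficients
  open QNumbers
  open FilterCounts
  open ListSums
  open import Data.Nat as ℕ using (ℕ; zero; suc; _≤_; _<_; _∸_; _≤ᵇ_; _≡ᵇ_; _<ᵇ_; z≤n; s≤s)
  import Data.Nat.Properties as NP
  open import Data.Bool using (Bool; true; false; if_then_else_; T; not; _∧_)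
  open import Data.List using (List; []; _∷_; filterᵇ; length; concatMap; _∷ʳ_)
  import Data.List.Properties as LP
  open import Data.List.Relation.Unary.All as All using (All; []; _∷_)
  import Data.List.Relation.Unary.All.Properties as AllP
  open import Data.Product using (_×_; _,_)
  open import Data.Unit using (⊤; tt)
  open import Data.Bool.Properties using (∧-zeroʳ)
  open import Data.Vec using (toList)
  open import Relation.Binary.PropositionalEquality as Eq using (_≡_; refl)
  open ℤq using (_⊕_; _⊗_; _≋_; ≋-refl; ≋-sym; ≋-trans; ⊕-cong; ⊗-cong)
  open SetoidR ℤq.≋-setoid
  open import Algebra.Properties.CommutativeSemigroup NP.+-commutativeSemigroup using () renaming (interchange to +-interchange)

  -- R_k(λ) row by row from the bottom: a new top row of length l ≥ μ₁ either holds
  -- no rook, and l - k of its cells count, or a rook in one of its l - k + 1 free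
  -- columns, the free cells to its right counting, which sums to [l - k + 1].
  rookNumber : ℕ → List ℕ → Poly
  rookNumber zero [] = 1P
  rookNumber (suc k) [] = []
  rookNumber zero (l ∷ ls) = qP^ l ⊗ rookNumber zero ls
  rookNumber (suc k) (l ∷ ls) = qP^ (l ∸ suc k) ⊗ rookNumber (suc k) ls ⊕ qint (l ∸ k) ⊗ rookNumber k ls

  rookNumber-vanish : ∀ k ls l → All (_≤ l) ls → l < k → rookNumber k ls ≋ []
  rookNumber-vanish (suc k) [] l a lk = ≋-refl
  rookNumber-vanish (suc k) (l' ∷ ls) l (l'≤l ∷ a) (s≤s lk) =
    ⊕-cong (ℤq.⊗-[]ʳ (qP^ (l' ∸ suc k)) (rookNumber-vanish (suc k) ls l a (s≤s lk)))
        (ℤq.⊗-[]ˡ _ (rookNumber k ls) (ℤq.≋-reflexive (Eq.cong qint (NP.m≤n⇒m∸n≡0 (NP.≤-trans l'≤l lk)))))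

  rookNumber-vanish-length : ∀ k ls → length ls < k → rookNumber k ls ≋ []
  rookNumber-vanish-length (suc k) [] _ = ≋-refl
  rookNumber-vanish-length (suc k) (l ∷ ls) (s≤s lt) =
    ⊕-cong (ℤq.⊗-[]ʳ (qP^ (l ∸ suc k)) (rookNumber-vanish-length (suc k) ls (NP.m≤n⇒m≤1+n lt))) (ℤq.⊗-[]ʳ (qint (l ∸ k)) (rookNumber-vanish-length k ls lt))

  data Decreasing : List ℕ → Set where
    [] : Decreasing []
    _∷_ : ∀ {l ls} → All (_≤ l) ls → Decreasing ls → Decreasing (l ∷ ls)

  module FreeColumns (rest : List (Maybe ℕ)) where
    isFree : ℕ → Bool
    isFree c = not (colOccurs (suc c) rest)
    counts : ℕ → ℕ → Bool
    counts c c' = cellCounts (just (suc c)) rest (suc c')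
    invWithRook : ℕ → ℕ → ℕ
    invWithRook l c = length (filterᵇ (counts c) (upTo l))
    freeCount : ℕ → ℕ
    freeCount l = length (filterᵇ isFree (upTo l))
    rookTerm : ℕ → ℕ → Poly
    rookTerm l c = if isFree c then qP^ (invWithRook l c) else []
    rookTermSum : ℕ → Poly
    rookTermSum l = ΣL (rookTerm l) (upTo l)

    upTo-suc : ∀ l → upTo (suc l) ≡ upTo l ∷ʳ l
    upTo-suc l = Eq.sym (LP.upTo-∷ʳ l)

    counts-< : ∀ c l → c < l → counts c l ≡ isFree l
    counts-< c l c<l rewrite ≡ᵇ-comm l c | <⇒≢ᵇ c<l | ≥⇒≮ᵇ {l} {c} (NP.<⇒≤ c<l) = refl

    invWithRook-suc : ∀ c l → c < l → invWithRook (suc l) c ≡ invWithRook l c ℕ.+ indicator (isFree l)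
    invWithRook-suc c l c<l = Eq.trans (Eq.cong (λ xs → length (filterᵇ (counts c) xs)) (upTo-suc l))
      (Eq.trans (len-filter-∷ʳ (counts c) (upTo l) l) (Eq.cong (λ b → invWithRook l c ℕ.+ indicator b) (counts-< c l c<l)))

    counts-self : ∀ l c' → c' < l → counts l c' ≡ false
    counts-self l c' c'<l rewrite <⇒≢ᵇ c'<l | <⇒<ᵇ≡true c'<l = refl

    invWithRook-self : ∀ l → invWithRook (suc l) l ≡ 0
    invWithRook-self l = Eq.trans (Eq.cong (λ xs → length (filterᵇ (counts l) xs)) (upTo-suc l))
      (Eq.trans (len-filter-∷ʳ (counts l) (upTo l) l)
        (Eq.cong₂ ℕ._+_ (len-filter-none (upTo l) (All.map (λ {c'} c'<l → counts-self l c' c'<l) (upTo-< l)))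
                        (Eq.cong (λ b → indicator (not b ∧ (not (l <ᵇ l) ∧ isFree l))) (≡ᵇ-refl l))))

    freeCount-suc : ∀ l → freeCount (suc l) ≡ freeCount l ℕ.+ indicator (isFree l)
    freeCount-suc l = Eq.trans (Eq.cong (λ xs → length (filterᵇ isFree xs)) (upTo-suc l)) (len-filter-∷ʳ isFree (upTo l) l)

    rookTermSum≋qint : ∀ l → rookTermSum l ≋ qint (freeCount l)
    rookTermSum≋qint zero = ≋-refl
    rookTermSum≋qint (suc l) = begin
      rookTermSum (suc l) ≡⟨ Eq.cong (ΣL (rookTerm (suc l))) (upTo-suc l) ⟩
      ΣL (rookTerm (suc l)) (upTo l ∷ʳ l) ≈⟨ ΣL-++ (rookTerm (suc l)) (upTo l) (l ∷ []) ⟩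
      ΣL (rookTerm (suc l)) (upTo l) ⊕ (rookTerm (suc l) l ⊕ [])
        ≈⟨ ⊕-cong (ΣL-cong (upTo-< l) (λ {c} c<l → ℤq.≋-reflexive (Eq.cong (λ g → if isFree c then qP^ g else []) (invWithRook-suc c l c<l))))
                  (⊕-cong (ℤq.≋-reflexive (Eq.cong (λ g → if isFree l then qP^ g else []) (invWithRook-self l))) (≋-refl {[]})) ⟩
      ΣL (λ c → if isFree c then qP^ (invWithRook l c ℕ.+ indicator (isFree l)) else []) (upTo l) ⊕ ((if isFree l then qP^ 0 else []) ⊕ [])
        ≈⟨ fin (isFree l) ⟩
      qint (freeCount l ℕ.+ indicator (isFree l)) ≡⟨ Eq.cong qint (Eq.sym (freeCount-suc l)) ⟩
      qint (freeCount (suc l)) ∎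
      where
      fin : ∀ b → ΣL (λ c → if isFree c then qP^ (invWithRook l c ℕ.+ indicator b) else []) (upTo l) ⊕ ((if b then qP^ 0 else []) ⊕ [])
                  ≋ qint (freeCount l ℕ.+ indicator b)
      fin false = begin
        ΣL (λ c → if isFree c then qP^ (invWithRook l c ℕ.+ 0) else []) (upTo l) ⊕ ([] ⊕ [])
          ≈⟨ ℤq.⊕-identityʳ _ ⟩
        ΣL (λ c → if isFree c then qP^ (invWithRook l c ℕ.+ 0) else []) (upTo l)
          ≈⟨ ΣL-cong (upTo-< l) (λ {c} _ → ℤq.≋-reflexive (Eq.cong (λ g → if isFree c then qP^ g else []) (NP.+-identityʳ (invWithRook l c)))) ⟩
        rookTermSum l ≈⟨ rookTermSum≋qint l ⟩
        qint (freeCount l) ≡⟨ Eq.cong qint (Eq.sym (NP.+-identityʳ (freeCount l))) ⟩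
        qint (freeCount l ℕ.+ 0) ∎
      fin true = begin
        ΣL (λ c → if isFree c then qP^ (invWithRook l c ℕ.+ 1) else []) (upTo l) ⊕ (qP^ 0 ⊕ [])
          ≈⟨ ⊕-cong (ΣL-cong (upTo-< l) (λ {c} _ → tm c)) (ℤq.⊕-identityʳ (qP^ 0)) ⟩
        ΣL (λ c → q ⊗ rookTerm l c) (upTo l) ⊕ 1P
          ≈⟨ ⊕-cong (ΣL-⊗ q (rookTerm l) (upTo l)) (≋-refl {1P}) ⟩
        q ⊗ rookTermSum l ⊕ 1P ≈⟨ ⊕-cong (⊗-cong (≋-refl {q}) (rookTermSum≋qint l)) (≋-refl {1P}) ⟩
        q ⊗ qint (freeCount l) ⊕ 1P ≈⟨ ℤq.⊕-comm (q ⊗ qint (freeCount l)) 1P ⟩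
        1P ⊕ q ⊗ qint (freeCount l) ≈⟨ ≋-sym (qint-suc (freeCount l)) ⟩
        qint (suc (freeCount l)) ≡⟨ Eq.cong qint (NP.+-comm 1 (freeCount l)) ⟩
        qint (freeCount l ℕ.+ 1) ∎
        where
        tm : ∀ c → (if isFree c then qP^ (invWithRook l c ℕ.+ 1) else []) ≋ q ⊗ rookTerm l c
        tm c with isFree c
        ... | true = ≋-trans (ℤq.≋-reflexive (Eq.cong qP^ (NP.+-comm (invWithRook l c) 1))) (qP^-suc (invWithRook l c))
        ... | false = ≋-sym (ℤq.⊗-zeroʳ q)

  ColumnIn : ℕ → Maybe ℕ → Set
  ColumnIn L nothing = ⊤
  ColumnIn L (just d) = (1 ≤ d) × (d ≤ L)

  ColumnsIn : ℕ → List (Maybe ℕ) → Set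
  ColumnsIn L p = All (ColumnIn L) p

  rooksUpTo : ℕ → List (Maybe ℕ) → ℕ
  rooksUpTo L [] = 0
  rooksUpTo L (nothing ∷ p) = rooksUpTo L p
  rooksUpTo L (just d ∷ p) = indicator (d ≤ᵇ L) ℕ.+ rooksUpTo L p

  rooksAt : ℕ → List (Maybe ℕ) → ℕ
  rooksAt c [] = 0
  rooksAt c (nothing ∷ p) = rooksAt c p
  rooksAt c (just d ∷ p) = indicator (c ≡ᵇ d) ℕ.+ rooksAt c p

  ≤ᵇ-suc : ∀ d L → (suc d ≤ᵇ suc L) ≡ (d ≤ᵇ L)
  ≤ᵇ-suc zero L = refl
  ≤ᵇ-suc (suc d) L = refl

  indicator-≤ᵇ-suc : ∀ d L → indicator (d ≤ᵇ suc L) ≡ indicator (d ≤ᵇ L) ℕ.+ indicator (suc L ≡ᵇ d)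
  indicator-≤ᵇ-suc zero L = refl
  indicator-≤ᵇ-suc (suc zero) zero = refl
  indicator-≤ᵇ-suc (suc (suc d)) zero with d
  ... | zero = refl
  ... | suc _ = refl
  indicator-≤ᵇ-suc (suc d) (suc L) rewrite ≤ᵇ-suc d (suc L) | ≤ᵇ-suc d L = indicator-≤ᵇ-suc d L

  rooksUpTo-suc : ∀ L p → rooksUpTo (suc L) p ≡ rooksUpTo L p ℕ.+ rooksAt (suc L) p
  rooksUpTo-suc L [] = refl
  rooksUpTo-suc L (nothing ∷ p) = rooksUpTo-suc L p
  rooksUpTo-suc L (just d ∷ p) rewrite rooksUpTo-suc L p | indicator-≤ᵇ-suc d L =
    +-interchange (indicator (d ≤ᵇ L)) (indicator (suc L ≡ᵇ d)) (rooksUpTo L p) (rooksAt (suc L) p)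

  ≡ᵇ⇒≡ : ∀ a b → (a ≡ᵇ b) ≡ true → a ≡ b
  ≡ᵇ⇒≡ zero zero _ = refl
  ≡ᵇ⇒≡ (suc a) (suc b) e = Eq.cong suc (≡ᵇ⇒≡ a b e)

  ∧-true : ∀ a b → (a ∧ b) ≡ true → (a ≡ true) × (b ≡ true)
  ∧-true true true _ = refl , refl

  rooksAt≡occurs : ∀ c p → nonAttacking p ≡ true → rooksAt c p ≡ indicator (colOccurs c p)
  rooksAt≡occurs c [] _ = refl
  rooksAt≡occurs c (nothing ∷ p) na = rooksAt≡occurs c p na
  rooksAt≡occurs c (just d ∷ p) na with ∧-true (not (colOccurs d p)) (nonAttacking p) na
  ... | nd , nap with c ≡ᵇ d in eq
  ... | false = rooksAt≡occurs c p nap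
  ... | true rewrite ≡ᵇ⇒≡ c d eq | rooksAt≡occurs d p nap with colOccurs d p
  ...   | false = refl

  indicator-not : ∀ b → indicator (not b) ℕ.+ indicator b ≡ 1
  indicator-not true = refl
  indicator-not false = refl

  PositiveColumn : Maybe ℕ → Set
  PositiveColumn nothing = ⊤
  PositiveColumn (just d) = 1 ≤ d

  ColumnsIn⇒positive : ∀ {L} p → ColumnsIn L p → All PositiveColumn p
  ColumnsIn⇒positive p b = All.map (λ {x} → w x) b
    where
    w : ∀ x → ColumnIn _ x → PositiveColumn x
    w nothing _ = tt
    w (just d) (a , c) = a

  rooksUpTo-0 : ∀ p → All PositiveColumn p → rooksUpTo 0 p ≡ 0
  rooksUpTo-0 [] _ = refl
  rooksUpTo-0 (nothing ∷ p) (_ ∷ b) = rooksUpTo-0 p b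
  rooksUpTo-0 (just (suc d) ∷ p) (_ ∷ b) = rooksUpTo-0 p b

  freeCount+rooksUpTo : ∀ l p → nonAttacking p ≡ true → All PositiveColumn p → FreeColumns.freeCount p l ℕ.+ rooksUpTo l p ≡ l
  freeCount+rooksUpTo zero p na ok = rooksUpTo-0 p ok
  freeCount+rooksUpTo (suc l) p na ok =
    Eq.trans (Eq.cong₂ ℕ._+_ (freeCount-suc l) (rooksUpTo-suc l p))
    (Eq.trans (Eq.cong (λ t → (freeCount l ℕ.+ indicator (isFree l)) ℕ.+ (rooksUpTo l p ℕ.+ t)) (rooksAt≡occurs (suc l) p na))
    (Eq.trans (+-interchange (freeCount l) (indicator (isFree l)) (rooksUpTo l p) (indicator (colOccurs (suc l) p)))
    (Eq.trans (Eq.cong₂ ℕ._+_ (freeCount+rooksUpTo l p na ok) (indicator-not (colOccurs (suc l) p))) (NP.+-comm l 1))))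
    where
    open FreeColumns p

  T⇒≡true : ∀ {b} → T b → b ≡ true
  T⇒≡true {true} _ = refl

  rooksUpTo-all : ∀ L p → ColumnsIn L p → rooksUpTo L p ≡ rookCount p
  rooksUpTo-all L [] _ = refl
  rooksUpTo-all L (nothing ∷ p) (_ ∷ b) = rooksUpTo-all L p b
  rooksUpTo-all L (just d ∷ p) ((_ , d≤L) ∷ b) rewrite T⇒≡true (NP.≤⇒≤ᵇ d≤L) = Eq.cong suc (rooksUpTo-all L p b)

  freeCount≡ : ∀ l p → nonAttacking p ≡ true → ColumnsIn l p → FreeColumns.freeCount p l ≡ l ∸ rookCount p
  freeCount≡ l p na b = Eq.trans (Eq.sym (NP.m+n∸n≡m (FreeColumns.freeCount p l) (rookCount p)))
    (Eq.cong (_∸ rookCount p) (Eq.trans (Eq.cong (FreeColumns.freeCount p l ℕ.+_) (Eq.sym (rooksUpTo-all l p b))) (freeCount+rooksUpTo l p na (ColumnsIn⇒positive p b))))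

  placeInRow : ℕ → List (Maybe ℕ) → List (List (Maybe ℕ))
  placeInRow l rest = (nothing ∷ rest) ∷ map (λ c → just (suc c) ∷ rest) (upTo l)

  assignments-ColumnsIn : ∀ ls L → All (_≤ L) ls → All (ColumnsIn L) (assignments ls)
  assignments-ColumnsIn [] L _ = [] ∷ []
  assignments-ColumnsIn (l ∷ ls) L (l≤L ∷ a) = AllP.concat⁺ (AllP.map⁺ (All.map (λ {rest} b → chOK rest b) (assignments-ColumnsIn ls L a)))
    where
    chOK : ∀ rest → ColumnsIn L rest → All (ColumnsIn L) (placeInRow l rest)
    chOK rest b = (tt ∷ b) ∷ AllP.map⁺ (All.map (λ {c} c<l → ((s≤s z≤n , NP.≤-trans c<l l≤L) ∷ b)) (upTo-< l))

  weight : ℕ → List ℕ → List (Maybe ℕ) → Poly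
  weight k ls p = if nonAttacking p ∧ (rookCount p ≡ᵇ k) then qP^ (inv ls p) else []

  rookRowWeight : ℕ → ℕ → List ℕ → List (Maybe ℕ) → Poly
  rookRowWeight l zero ls rest = []
  rookRowWeight l (suc k) ls rest = qint (l ∸ k) ⊗ weight k ls rest

  module PlaceInRow (l : ℕ) (ls : List ℕ) (rest : List (Maybe ℕ)) (b : ColumnsIn l rest) where
    open FreeColumns rest

    weight-noRook : ∀ k → weight k (l ∷ ls) (nothing ∷ rest) ≋ qP^ (l ∸ k) ⊗ weight k ls rest
    weight-noRook k with nonAttacking rest in na
    ... | false = ≋-sym (ℤq.⊗-zeroʳ (qP^ (l ∸ k)))
    ... | true with rookCount rest ≡ᵇ k in e
    ...   | false = ≋-sym (ℤq.⊗-zeroʳ (qP^ (l ∸ k)))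
    ...   | true = ≋-trans (qP^-+ (freeCount l) (inv ls rest))
                     (⊗-cong (ℤq.≋-reflexive (Eq.cong qP^ (Eq.trans (freeCount≡ l rest na b) (Eq.cong (l ∸_) (≡ᵇ⇒≡ (rookCount rest) k e))))) (≋-refl {qP^ (inv ls rest)}))

    withRookAt : ℕ → List (Maybe ℕ)
    withRookAt c = just (suc c) ∷ rest

    ∑weight-withRook : ∀ k → ΣL (λ c → weight k (l ∷ ls) (withRookAt c)) (upTo l) ≋ rookRowWeight l k ls rest
    ∑weight-withRook zero = ΣL-zero (upTo l) (λ c → ℤq.≋-reflexive (Eq.cong (λ t → if t then qP^ (inv (l ∷ ls) (withRookAt c)) else []) (∧-zeroʳ _)))
    ∑weight-withRook (suc k') with nonAttacking rest in na
    ... | false = ≋-trans (ΣL-zero (upTo l) (λ c → ℤq.≋-reflexive (Eq.cong (λ t → if t ∧ _ then qP^ (inv (l ∷ ls) (withRookAt c)) else []) (∧-zeroʳ (isFree c)))))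
                          (≋-sym (ℤq.⊗-zeroʳ (qint (l ∸ k'))))
    ... | true with rookCount rest ≡ᵇ k' in e
    ...   | false = ≋-trans (ΣL-zero (upTo l) (λ c → ℤq.≋-reflexive (Eq.cong (λ t → if t then qP^ (inv (l ∷ ls) (withRookAt c)) else []) (∧-zeroʳ _))))
                            (≋-sym (ℤq.⊗-zeroʳ (qint (l ∸ k'))))
    ...   | true = begin
      ΣL (λ c → if (isFree c ∧ true) ∧ true then qP^ (invWithRook l c ℕ.+ inv ls rest) else []) (upTo l)
        ≈⟨ ΣL-cong (upTo-< l) (λ {c} _ → tm c) ⟩
      ΣL (λ c → qP^ (inv ls rest) ⊗ rookTerm l c) (upTo l) ≈⟨ ΣL-⊗ (qP^ (inv ls rest)) (rookTerm l) (upTo l) ⟩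
      qP^ (inv ls rest) ⊗ rookTermSum l ≈⟨ ⊗-cong (≋-refl {qP^ (inv ls rest)}) (rookTermSum≋qint l) ⟩
      qP^ (inv ls rest) ⊗ qint (freeCount l) ≈⟨ ℤq.⊗-comm (qP^ (inv ls rest)) (qint (freeCount l)) ⟩
      qint (freeCount l) ⊗ qP^ (inv ls rest) ≡⟨ Eq.cong (λ t → qint t ⊗ qP^ (inv ls rest)) (Eq.trans (freeCount≡ l rest na b) (Eq.cong (l ∸_) (≡ᵇ⇒≡ (rookCount rest) k' e))) ⟩
      qint (l ∸ k') ⊗ qP^ (inv ls rest) ∎
      where
      tm : ∀ c → (if (isFree c ∧ true) ∧ true then qP^ (invWithRook l c ℕ.+ inv ls rest) else []) ≋ qP^ (inv ls rest) ⊗ rookTerm l c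
      tm c with isFree c
      ... | true = ≋-trans (qP^-+ (invWithRook l c) (inv ls rest)) (ℤq.⊗-comm (qP^ (invWithRook l c)) (qP^ (inv ls rest)))
      ... | false = ≋-sym (ℤq.⊗-zeroʳ (qP^ (inv ls rest)))

    ∑weight-placeInRow : ∀ k → ΣL (weight k (l ∷ ls)) (placeInRow l rest) ≋ qP^ (l ∸ k) ⊗ weight k ls rest ⊕ rookRowWeight l k ls rest
    ∑weight-placeInRow k = ⊕-cong (weight-noRook k) (≋-trans (ℤq.≋-reflexive (ΣL-map (weight k (l ∷ ls)) withRookAt (upTo l))) (∑weight-withRook k))

  ∑weight≋rookNumber : ∀ k ls → Decreasing ls → ΣL (weight k ls) (assignments ls) ≋ rookNumber k ls
  ∑weight≋rookNumber zero [] _ = ≋-refl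
  ∑weight≋rookNumber (suc k) [] _ = ≋-refl
  ∑weight≋rookNumber k (l ∷ μ) (a ∷ s) = begin
    ΣL (weight k (l ∷ μ)) (concatMap (placeInRow l) (assignments μ)) ≈⟨ ΣL-concatMap (weight k (l ∷ μ)) (placeInRow l) (assignments μ) ⟩
    ΣL (λ rest → ΣL (weight k (l ∷ μ)) (placeInRow l rest)) (assignments μ)
      ≈⟨ ΣL-cong (assignments-ColumnsIn μ l a) (λ {rest} b → PlaceInRow.∑weight-placeInRow l μ rest b k) ⟩
    ΣL (λ rest → qP^ (l ∸ k) ⊗ weight k μ rest ⊕ rookRowWeight l k μ rest) (assignments μ)
      ≈⟨ ΣL-⊕ (λ rest → qP^ (l ∸ k) ⊗ weight k μ rest) (rookRowWeight l k μ) (assignments μ) ⟩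
    ΣL (λ rest → qP^ (l ∸ k) ⊗ weight k μ rest) (assignments μ) ⊕ ΣL (rookRowWeight l k μ) (assignments μ)
      ≈⟨ ⊕-cong (≋-trans (ΣL-⊗ (qP^ (l ∸ k)) (weight k μ) (assignments μ)) (⊗-cong (≋-refl {qP^ (l ∸ k)}) (∑weight≋rookNumber k μ s))) (≋-refl {ΣL (rookRowWeight l k μ) (assignments μ)}) ⟩
    qP^ (l ∸ k) ⊗ rookNumber k μ ⊕ ΣL (rookRowWeight l k μ) (assignments μ) ≈⟨ fin k ⟩
    rookNumber k (l ∷ μ) ∎
    where
    fin : ∀ k → qP^ (l ∸ k) ⊗ rookNumber k μ ⊕ ΣL (rookRowWeight l k μ) (assignments μ) ≋ rookNumber k (l ∷ μ)
    fin zero = ≋-trans (⊕-cong (≋-refl {qP^ l ⊗ rookNumber 0 μ}) (ΣL-zero (assignments μ) (λ _ → ≋-refl))) (ℤq.⊕-identityʳ _)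
    fin (suc k') = ⊕-cong (≋-refl {qP^ (l ∸ suc k') ⊗ rookNumber (suc k') μ})
      (≋-trans (ΣL-⊗ (qint (l ∸ k')) (weight k' μ) (assignments μ)) (⊗-cong (≋-refl {qint (l ∸ k')}) (∑weight≋rookNumber k' μ s)))

  rookPoly≋rookNumber : ∀ {n} k (lam : Vec ℕ n) → Decreasing (toList lam) → rookPoly k lam ≋ rookNumber k (toList lam)
  rookPoly≋rookNumber k lam s = ≋-trans (ℤq.≋-reflexive (sumP-map (λ p → qP^ (inv ls p)) (filterᵇ (λ p → nonAttacking p ∧ (rookCount p ≡ᵇ k)) (assignments ls))))
    (≋-trans (ΣL-filter (λ p → qP^ (inv ls p)) (λ p → nonAttacking p ∧ (rookCount p ≡ᵇ k)) (assignments ls)) (∑weight≋rookNumber k ls s))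
    where ls = toList lam

module ColumnRemoval where

  open Coefficients
  open QNumbers
  open FilterCounts using (upTo-<)
  open ListSums using (ΣL; ΣL-++; ΣL-cong; ΣL-⊗)
  open RookNumbers using (rookNumber; rookNumber-vanish; Decreasing; []; _∷_)
  open import Data.Nat as ℕ using (ℕ; zero; suc; _≤_; _<_; _∸_; _≤ᵇ_; z≤n; s≤s)
  import Data.Nat.Properties as NP
  open import Data.Bool using (true; false; if_then_else_; T)
  open import Data.Empty using (⊥-elim)
  open import Data.List using (List; []; _∷_; _++_)
  import Data.List.Properties as LP
  open import Data.List.Relation.Unary.All as All using (All; []; _∷_)
  import Data.List.Relation.Unary.All.Properties as AllP
  open import Relation.Nullary using (yes; no)
  open import Relation.Binary.PropositionalEquality as Eq using (_≡_)
  open ℤq using (_⊕_; _⊗_; ⊝; _≋_; ≋-refl; ≋-sym; ≋-trans; ⊕-cong; ⊗-cong)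
  open ℤq-Solver using (solve; _⊜_; _:+_; _:*_; :-_; Κ)
  open SetoidR ℤq.≋-setoid

  qSum : ℕ → (ℕ → Poly) → Poly
  qSum zero F = []
  qSum (suc m) F = q ⊗ qSum m F ⊕ F (suc m)

  qSum-cong : ∀ m {F G} → (∀ j → 1 ≤ j → j ≤ m → F j ≋ G j) → qSum m F ≋ qSum m G
  qSum-cong zero e = ≋-refl
  qSum-cong (suc m) e = ⊕-cong (⊗-cong (≋-refl {q}) (qSum-cong m (λ j a b → e j a (NP.m≤n⇒m≤1+n b))))
                            (e (suc m) (s≤s z≤n) NP.≤-refl)

  qSum-⊕ : ∀ m F G → qSum m (λ j → F j ⊕ G j) ≋ qSum m F ⊕ qSum m G
  qSum-⊕ zero F G = ≋-refl
  qSum-⊕ (suc m) F G = begin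
    q ⊗ qSum m (λ j → F j ⊕ G j) ⊕ (F (suc m) ⊕ G (suc m))
      ≈⟨ ⊕-cong (⊗-cong (≋-refl {q}) (qSum-⊕ m F G)) ≋-refl ⟩
    q ⊗ (qSum m F ⊕ qSum m G) ⊕ (F (suc m) ⊕ G (suc m))
      ≈⟨ solve 5 (λ x a b c d → x :* (a :+ b) :+ (c :+ d) ⊜ (x :* a :+ c) :+ (x :* b :+ d)) ≋-refl q (qSum m F) (qSum m G) (F (suc m)) (G (suc m)) ⟩
    (q ⊗ qSum m F ⊕ F (suc m)) ⊕ (q ⊗ qSum m G ⊕ G (suc m)) ∎

  qSum-⊗ : ∀ m c F → qSum m (λ j → c ⊗ F j) ≋ c ⊗ qSum m F
  qSum-⊗ zero c F = ≋-sym (ℤq.⊗-zeroʳ c)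
  qSum-⊗ (suc m) c F = begin
    q ⊗ qSum m (λ j → c ⊗ F j) ⊕ c ⊗ F (suc m)
      ≈⟨ ⊕-cong (⊗-cong (≋-refl {q}) (qSum-⊗ m c F)) ≋-refl ⟩
    q ⊗ (c ⊗ qSum m F) ⊕ c ⊗ F (suc m)
      ≈⟨ solve 4 (λ x c a b → x :* (c :* a) :+ c :* b ⊜ c :* (x :* a :+ b)) ≋-refl q c (qSum m F) (F (suc m)) ⟩
    c ⊗ (q ⊗ qSum m F ⊕ F (suc m)) ∎

  qSum-split : ∀ d l F c → (∀ j → l < j → F j ≋ c) → qSum (d ℕ.+ l) F ≋ qP^ d ⊗ qSum l F ⊕ qint d ⊗ c
  qSum-split zero l F c e = ≋-sym (≋-trans (⊕-cong (ℤq.⊗-identityˡ (qSum l F)) ≋-refl) (ℤq.⊕-identityʳ _))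
  qSum-split (suc d) l F c e = begin
    q ⊗ qSum (d ℕ.+ l) F ⊕ F (suc (d ℕ.+ l))
      ≈⟨ ⊕-cong (⊗-cong (≋-refl {q}) (qSum-split d l F c e)) (e (suc (d ℕ.+ l)) (s≤s (NP.m≤n+m l d))) ⟩
    q ⊗ (qP^ d ⊗ qSum l F ⊕ qint d ⊗ c) ⊕ c
      ≈⟨ solve 5 (λ x Q W I c → x :* (Q :* W :+ I :* c) :+ c ⊜ (x :* Q) :* W :+ (Κ 1P :+ x :* I) :* c) ≋-refl q (qP^ d) (qSum l F) (qint d) c ⟩
    (q ⊗ qP^ d) ⊗ qSum l F ⊕ (1P ⊕ q ⊗ qint d) ⊗ c
      ≈⟨ ⊕-cong (⊗-cong (≋-sym (qP^-suc d)) ≋-refl) (⊗-cong (≋-sym (qint-suc d)) (≋-refl {c})) ⟩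
    qP^ (suc d) ⊗ qSum l F ⊕ qint (suc d) ⊗ c ∎

  qSum-const : ∀ m c → qSum m (λ _ → c) ≋ qint m ⊗ c
  qSum-const m c = ≋-trans (ℤq.≋-reflexive (Eq.cong (λ t → qSum t (λ _ → c)) (Eq.sym (NP.+-identityʳ m))))
    (≋-trans (qSum-split m 0 (λ _ → c) c (λ _ _ → ≋-refl)) (≋-trans (⊕-cong (ℤq.⊗-zeroʳ (qP^ m)) ≋-refl) ≋-refl))

  shortenRow : ℕ → ℕ → ℕ
  shortenRow j l = if j ≤ᵇ l then l ∸ 1 else l

  removeColList : ℕ → List ℕ → List ℕ
  removeColList j = map (shortenRow j)

  shortenRow-short : ∀ j l → l < j → shortenRow j l ≡ l
  shortenRow-short j l lj with j ≤ᵇ l in eq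
  ... | false = Eq.refl
  ... | true = ⊥-elim (NP.<⇒≱ lj (NP.≤ᵇ⇒≤ j l (Eq.subst T (Eq.sym eq) _)))

  removeColList-short : ∀ j ls l → All (_≤ l) ls → l < j → removeColList j ls ≡ ls
  removeColList-short j [] l a lj = Eq.refl
  removeColList-short j (x ∷ ls) l (x≤l ∷ a) lj = Eq.cong₂ _∷_ (shortenRow-short j x (NP.≤-<-trans x≤l lj)) (removeColList-short j ls l a lj)

  shortenRow-long : ∀ j l → 1 ≤ j → j ≤ l → shortenRow j l ≡ l ∸ 1
  shortenRow-long j l _ jl with j ≤ᵇ l in eq
  ... | true = Eq.refl
  ... | false = ⊥-elim (Eq.subst T eq (NP.≤⇒≤ᵇ jl))

  removeColSum : ℕ → ℕ → List ℕ → Poly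
  removeColSum m k ls = qint (m ∸ k) ⊗ rookNumber k ls ⊕ ⊝ (qP^ (m ∸ suc k) ⊗ (q^[1+ k ]-1 ⊗ rookNumber (suc k) ls))

  removeColSum-vanish : ∀ m k ls → rookNumber (suc k) ls ≋ [] → removeColSum m k ls ≋ qint (m ∸ k) ⊗ rookNumber k ls
  removeColSum-vanish m k ls e = ℤq.≋-⊕[]ʳ ≋-refl (ℤq.⊝-cong (ℤq.⊗-[]ʳ (qP^ (m ∸ suc k)) (ℤq.⊗-[]ʳ (q^[1+ k ]-1) e)))

  ∸≡suc∸suc : ∀ l k → suc k ≤ l → l ∸ k ≡ suc (l ∸ suc k)
  ∸≡suc∸suc (suc l) zero _ = Eq.refl
  ∸≡suc∸suc (suc l) (suc k) (s≤s p) = ∸≡suc∸suc l k p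

  ∸-split : ∀ m l k → k ≤ l → l ≤ m → m ∸ k ≡ (m ∸ l) ℕ.+ (l ∸ k)
  ∸-split m l k kl lm = Eq.trans (Eq.cong (_∸ k) (Eq.sym (NP.m∸n+n≡m lm))) (NP.+-∸-assoc (m ∸ l) kl)

  -- q^(l'-k'-1)·q^(k'+2) = q^(l'-k')·q^(k'+1) unless k' ≥ l', and then [l'-k'] = 0.
  qint⊗exponent-balance : ∀ l' k' R →
    qint (l' ∸ k') ⊗ (R ⊗ (qP^ (l' ∸ suc k') ⊗ qP^ (suc (suc k')) ⊕ ⊝ (qP^ (l' ∸ k') ⊗ qP^ (suc k')))) ≋ []
  qint⊗exponent-balance l' k' R with suc k' ℕ.≤? l'
  ... | yes p = ℤq.⊗-[]ʳ (qint a') (ℤq.⊗-[]ʳ R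
          (≋-trans (⊕-cong (≋-refl {qP^ b ⊗ qP^ (suc (suc k'))}) (ℤq.⊝-cong eqn)) (ℤq.⊝-inverseʳ (qP^ b ⊗ qP^ (suc (suc k'))))))
    where
    a' : ℕ
    a' = l' ∸ k'
    b : ℕ
    b = l' ∸ suc k'
    eqn : qP^ a' ⊗ qP^ (suc k') ≋ qP^ b ⊗ qP^ (suc (suc k'))
    eqn = begin
      qP^ a' ⊗ qP^ (suc k') ≈⟨ ⊗-cong (ℤq.≋-reflexive (Eq.cong qP^ (∸≡suc∸suc l' k' p))) (≋-refl {qP^ (suc k')}) ⟩
      qP^ (suc b) ⊗ qP^ (suc k') ≈⟨ ⊗-cong (qP^-suc b) (≋-refl {qP^ (suc k')}) ⟩
      (q ⊗ qP^ b) ⊗ qP^ (suc k') ≈⟨ solve 3 (λ x Q K → (x :* Q) :* K ⊜ Q :* (x :* K)) ≋-refl q (qP^ b) (qP^ (suc k')) ⟩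
      qP^ b ⊗ (q ⊗ qP^ (suc k')) ≈⟨ ⊗-cong (≋-refl {qP^ b}) (≋-sym (qP^-suc (suc k'))) ⟩
      qP^ b ⊗ qP^ (suc (suc k')) ∎
  ... | no np = ℤq.⊗-[]ˡ _ _ (ℤq.≋-reflexive (Eq.cong qint (NP.m≤n⇒m∸n≡0 (NP.≤-pred (NP.≰⇒> np)))))

  qSum-removeCol-full : ∀ l μ k → All (_≤ l) μ → (∀ k → qSum l (λ j → rookNumber k (removeColList j μ)) ≋ removeColSum l k μ) →
         qSum l (λ j → rookNumber k (removeColList j (l ∷ μ))) ≋ removeColSum l k (l ∷ μ)
  qSum-removeCol-full zero μ k a IH = ≋-sym (≋-trans (removeColSum-vanish 0 k (0 ∷ μ) (rookNumber-vanish (suc k) (0 ∷ μ) 0 (z≤n ∷ a) (s≤s z≤n)))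
                          (ℤq.⊗-[]ˡ _ (rookNumber k (0 ∷ μ)) (ℤq.≋-reflexive (Eq.cong qint (NP.0∸n≡0 k)))))
  qSum-removeCol-full (suc l') μ zero a IH = begin
    qSum (suc l') (λ j → rookNumber 0 (removeColList j (suc l' ∷ μ)))
      ≈⟨ qSum-cong (suc l') (λ j 1j jl → ℤq.≋-reflexive (Eq.cong (λ t → rookNumber 0 (t ∷ removeColList j μ)) (shortenRow-long j (suc l') 1j jl))) ⟩
    qSum (suc l') (λ j → qP^ l' ⊗ rookNumber 0 (removeColList j μ)) ≈⟨ qSum-⊗ (suc l') (qP^ l') (λ j → rookNumber 0 (removeColList j μ)) ⟩
    qP^ l' ⊗ qSum (suc l') (λ j → rookNumber 0 (removeColList j μ)) ≈⟨ ⊗-cong (≋-refl {qP^ l'}) (IH 0) ⟩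
    qP^ l' ⊗ removeColSum (suc l') 0 μ
      ≈⟨ ℤq.≋-⊕[]ʳ (solve 6 (λ x Q Q1 I A B →
           Q :* (I :* A :+ :- (Q :* ((x :+ :- Κ 1P) :* B)))
           ⊜ I :* (Q1 :* A) :+ :- (Q :* ((x :+ :- Κ 1P) :* (Q :* B :+ I :* A))) :+ I :* (A :* (Q :* x :+ :- Q1)))
           ≋-refl q (qP^ l') (qP^ (suc l')) (qint (suc l')) (rookNumber 0 μ) (rookNumber 1 μ))
         (ℤq.⊗-[]ʳ (qint (suc l')) (ℤq.⊗-[]ʳ (rookNumber 0 μ) (≋-trans (⊕-cong (≋-trans (ℤq.⊗-comm (qP^ l') q) (≋-sym (qP^-suc l'))) (≋-refl {⊝ (qP^ (suc l'))})) (ℤq.⊝-inverseʳ (qP^ (suc l')))))) ⟩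
    removeColSum (suc l') 0 (suc l' ∷ μ) ∎
  qSum-removeCol-full (suc l') μ (suc k') a IH = begin
    qSum (suc l') (λ j → rookNumber (suc k') (removeColList j (suc l' ∷ μ)))
      ≈⟨ qSum-cong (suc l') (λ j 1j jl → ℤq.≋-reflexive (Eq.cong (λ t → rookNumber (suc k') (t ∷ removeColList j μ)) (shortenRow-long j (suc l') 1j jl))) ⟩
    qSum (suc l') (λ j → qP^ (l' ∸ suc k') ⊗ rookNumber (suc k') (removeColList j μ) ⊕ qint (l' ∸ k') ⊗ rookNumber k' (removeColList j μ))
      ≈⟨ qSum-⊕ (suc l') (λ j → qP^ (l' ∸ suc k') ⊗ rookNumber (suc k') (removeColList j μ)) (λ j → qint (l' ∸ k') ⊗ rookNumber k' (removeColList j μ)) ⟩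
    qSum (suc l') (λ j → qP^ (l' ∸ suc k') ⊗ rookNumber (suc k') (removeColList j μ)) ⊕ qSum (suc l') (λ j → qint (l' ∸ k') ⊗ rookNumber k' (removeColList j μ))
      ≈⟨ ⊕-cong (qSum-⊗ (suc l') (qP^ b) (λ j → rookNumber (suc k') (removeColList j μ))) (qSum-⊗ (suc l') (qint a') (λ j → rookNumber k' (removeColList j μ))) ⟩
    qP^ b ⊗ qSum (suc l') (λ j → rookNumber (suc k') (removeColList j μ)) ⊕ qint a' ⊗ qSum (suc l') (λ j → rookNumber k' (removeColList j μ))
      ≈⟨ ⊕-cong (⊗-cong (≋-refl {qP^ b}) (IH (suc k'))) (⊗-cong (≋-refl {qint a'}) (IH k')) ⟩
    qP^ b ⊗ removeColSum (suc l') (suc k') μ ⊕ qint a' ⊗ removeColSum (suc l') k' μ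
      ≈⟨ ℤq.≋-⊕[]ʳ (solve 9 (λ K K2 Qa Qb Ia Ic Rk Rk1 Rk' →
            Qb :* (Ia :* Rk :+ :- (Qb :* ((K2 :+ :- Κ 1P) :* Rk1))) :+ Ia :* (Ic :* Rk' :+ :- (Qa :* ((K :+ :- Κ 1P) :* Rk)))
            ⊜ Ia :* (Qa :* Rk :+ Ic :* Rk') :+ :- (Qb :* ((K2 :+ :- Κ 1P) :* (Qb :* Rk1 :+ Ia :* Rk)))
              :+ Ia :* (Rk :* (Qb :* K2 :+ :- (Qa :* K))))
            ≋-refl (qP^ (suc k')) (qP^ (suc (suc k'))) (qP^ a') (qP^ b) (qint a') (qint (suc l' ∸ k'))
                   (rookNumber (suc k') μ) (rookNumber (suc (suc k')) μ) (rookNumber k' μ))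
         (qint⊗exponent-balance l' k' (rookNumber (suc k') μ)) ⟩
    removeColSum (suc l') (suc k') (suc l' ∷ μ) ∎
    where
    a' : ℕ
    a' = l' ∸ k'
    b : ℕ
    b = l' ∸ suc k'

  removeColSum-widen : ∀ m l k μ → l ≤ m → All (_≤ l) μ →
          qP^ (m ∸ l) ⊗ removeColSum l k (l ∷ μ) ⊕ qint (m ∸ l) ⊗ rookNumber k (l ∷ μ) ≋ removeColSum m k (l ∷ μ)
  removeColSum-widen m l k μ lm a with suc k ℕ.≤? l
  ... | yes p = begin
    qP^ d ⊗ (qint (l ∸ k) ⊗ Rk ⊕ ⊝ (qP^ (l ∸ suc k) ⊗ (q^[1+ k ]-1 ⊗ Rk1))) ⊕ qint d ⊗ Rk
      ≈⟨ solve 7 (λ Qd Id Ia Qc E Rk Rk1 →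
            Qd :* (Ia :* Rk :+ :- (Qc :* (E :* Rk1))) :+ Id :* Rk
            ⊜ (Id :+ Qd :* Ia) :* Rk :+ :- ((Qd :* Qc) :* (E :* Rk1)))
          ≋-refl (qP^ d) (qint d) (qint (l ∸ k)) (qP^ (l ∸ suc k)) (q^[1+ k ]-1) Rk Rk1 ⟩
    (qint d ⊕ qP^ d ⊗ qint (l ∸ k)) ⊗ Rk ⊕ ⊝ ((qP^ d ⊗ qP^ (l ∸ suc k)) ⊗ (q^[1+ k ]-1 ⊗ Rk1))
      ≈⟨ ⊕-cong (⊗-cong (≋-sym (≋-trans (ℤq.≋-reflexive (Eq.cong qint (∸-split m l k (NP.<⇒≤ p) lm))) (qint-+ d (l ∸ k)))) (≋-refl {Rk}))
                (ℤq.⊝-cong (⊗-cong (≋-sym (≋-trans (ℤq.≋-reflexive (Eq.cong qP^ (∸-split m l (suc k) p lm))) (qP^-+ d (l ∸ suc k)))) (≋-refl {q^[1+ k ]-1 ⊗ Rk1}))) ⟩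
    removeColSum m k (l ∷ μ) ∎
    where
    d : ℕ
    d = m ∸ l
    Rk : Poly
    Rk = rookNumber k (l ∷ μ)
    Rk1 : Poly
    Rk1 = rookNumber (suc k) (l ∷ μ)
  ... | no np = begin
    qP^ (m ∸ l) ⊗ removeColSum l k (l ∷ μ) ⊕ qint (m ∸ l) ⊗ Rk
      ≈⟨ ⊕-cong (ℤq.⊗-[]ʳ (qP^ (m ∸ l)) (≋-trans (removeColSum-vanish l k (l ∷ μ) van) (ℤq.⊗-[]ˡ _ Rk (ℤq.≋-reflexive (Eq.cong qint (NP.m≤n⇒m∸n≡0 lk)))))) (≋-refl {qint (m ∸ l) ⊗ Rk}) ⟩
    qint (m ∸ l) ⊗ Rk ≈⟨ fin ⟩
    qint (m ∸ k) ⊗ Rk ≈⟨ ≋-sym (removeColSum-vanish m k (l ∷ μ) van) ⟩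
    removeColSum m k (l ∷ μ) ∎
    where
    Rk : Poly
    Rk = rookNumber k (l ∷ μ)
    lk : l ≤ k
    lk = NP.≤-pred (NP.≰⇒> np)
    van : rookNumber (suc k) (l ∷ μ) ≋ []
    van = rookNumber-vanish (suc k) (l ∷ μ) l (NP.≤-refl ∷ a) (s≤s lk)
    fin : qint (m ∸ l) ⊗ Rk ≋ qint (m ∸ k) ⊗ Rk
    fin with l ℕ.≟ k
    ... | yes Eq.refl = ≋-refl
    ... | no l≢k =
      let z = rookNumber-vanish k (l ∷ μ) l (NP.≤-refl ∷ a) (NP.≤∧≢⇒< lk l≢k) in
      ≋-trans (ℤq.⊗-[]ʳ (qint (m ∸ l)) z) (≋-sym (ℤq.⊗-[]ʳ (qint (m ∸ k)) z))

  -- Columns right of the top row leave λ unchanged; the others shorten the top row,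
  -- and qSum-removeCol-full reduces them to the rows below.
  qSum-removeCol : ∀ ls m k → Decreasing ls → All (_≤ m) ls → qSum m (λ j → rookNumber k (removeColList j ls)) ≋ removeColSum m k ls
  qSum-removeCol [] m k s b = ≋-trans (qSum-const m (rookNumber k [])) (base k)
    where
    base : ∀ k → qint m ⊗ rookNumber k [] ≋ removeColSum m k []
    base zero = ≋-sym (removeColSum-vanish m 0 [] ≋-refl)
    base (suc k) = ≋-trans (ℤq.⊗-[]ʳ (qint m) ≋-refl) (≋-sym (≋-trans (removeColSum-vanish m (suc k) [] ≋-refl) (ℤq.⊗-[]ʳ (qint (m ∸ suc k)) ≋-refl)))
  qSum-removeCol (l ∷ μ) m k (a ∷ s) (lm ∷ _) = begin
    qSum m F ≡⟨ Eq.cong (λ t → qSum t F) (Eq.sym (NP.m∸n+n≡m lm)) ⟩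
    qSum ((m ∸ l) ℕ.+ l) F
      ≈⟨ qSum-split (m ∸ l) l F (rookNumber k (l ∷ μ)) (λ j lj → ℤq.≋-reflexive (Eq.cong (rookNumber k) (removeColList-short j (l ∷ μ) l (NP.≤-refl ∷ a) lj))) ⟩
    qP^ (m ∸ l) ⊗ qSum l F ⊕ qint (m ∸ l) ⊗ rookNumber k (l ∷ μ)
      ≈⟨ ⊕-cong (⊗-cong (≋-refl {qP^ (m ∸ l)}) (qSum-removeCol-full l μ k a (λ k' → qSum-removeCol μ l k' s a))) ≋-refl ⟩
    qP^ (m ∸ l) ⊗ removeColSum l k (l ∷ μ) ⊕ qint (m ∸ l) ⊗ rookNumber k (l ∷ μ) ≈⟨ removeColSum-widen m l k μ lm a ⟩
    removeColSum m k (l ∷ μ) ∎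
    where
    F : ℕ → Poly
    F = λ j → rookNumber k (removeColList j (l ∷ μ))

  ΣL≋qSum : ∀ m F → ΣL (λ j → qP^ (m ∸ j) ⊗ F j) (map suc (upTo m)) ≋ qSum m F
  ΣL≋qSum zero F = ≋-refl
  ΣL≋qSum (suc m) F = begin
    ΣL G (map suc (upTo (suc m))) ≡⟨ Eq.cong (ΣL G) (Eq.trans (Eq.cong (map suc) (Eq.sym (LP.upTo-∷ʳ m))) (LP.map-++ suc (upTo m) (m ∷ []))) ⟩
    ΣL G (map suc (upTo m) ++ (suc m ∷ [])) ≈⟨ ΣL-++ G (map suc (upTo m)) (suc m ∷ []) ⟩
    ΣL G (map suc (upTo m)) ⊕ (G (suc m) ⊕ [])
      ≈⟨ ⊕-cong (ΣL-cong (AllP.map⁺ (All.map (λ c<m → c<m) (upTo-< m))) (λ {j} j≤m → tm j j≤m))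
                (≋-trans (ℤq.⊕-identityʳ (G (suc m))) (≋-trans (⊗-cong (ℤq.≋-reflexive (Eq.cong qP^ (NP.n∸n≡0 m))) (≋-refl {F (suc m)})) (ℤq.⊗-identityˡ (F (suc m))))) ⟩
    ΣL (λ j → q ⊗ (qP^ (m ∸ j) ⊗ F j)) (map suc (upTo m)) ⊕ F (suc m)
      ≈⟨ ⊕-cong (ΣL-⊗ q (λ j → qP^ (m ∸ j) ⊗ F j) (map suc (upTo m))) (≋-refl {F (suc m)}) ⟩
    q ⊗ ΣL (λ j → qP^ (m ∸ j) ⊗ F j) (map suc (upTo m)) ⊕ F (suc m)
      ≈⟨ ⊕-cong (⊗-cong (≋-refl {q}) (ΣL≋qSum m F)) (≋-refl {F (suc m)}) ⟩
    qSum (suc m) F ∎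
    where
    G : ℕ → Poly
    G = λ j → qP^ (suc m ∸ j) ⊗ F j
    tm : ∀ j → j ≤ m → G j ≋ q ⊗ (qP^ (m ∸ j) ⊗ F j)
    tm j j≤m = ≋-trans (⊗-cong (≋-trans (ℤq.≋-reflexive (Eq.cong qP^ (NP.+-∸-assoc 1 j≤m))) (qP^-suc (m ∸ j))) (≋-refl {F j}))
                       (ℤq.⊗-assoc q (qP^ (m ∸ j)) (F j))

module Dilation where

  open Coefficients
  open QNumbers
  open import Data.Nat using (ℕ; zero; suc)
  open import Data.Integer as ℤ using (+_; -_)
  open import Data.Integer.Properties using (-1*i≡-i)
  open import Data.List using ([]; _∷_)
  open ℤq using (_⊕_; _⊗_; ⊝; _≋_; ≋-refl; ≋-sym; ≋-trans; ⊕-cong; ⊗-cong)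
  open ℤqx using () renaming (_⊕_ to _⊕X_; _⊗_ to _⊗X_; _≋_ to _≋X_; mk≋ to mk≋X; get to getX;
    ≋-refl to ≋X-refl; ≋-sym to ≋X-sym; ≋-trans to ≋X-trans; ⊕-cong to ⊕X-cong; ⊗-cong to ⊗X-cong;
    cons-cong to consX-cong; scale to scaleX′; coeff to coeffX′)
  open ℤq-Solver using (solve; _⊜_; _:*_; :-_)
  private
    module RZ = SetoidR ℤq.≋-setoid
    module RX = SetoidR ℤqx.≋-setoid

  dilate : PolyX → PolyX
  dilate [] = []
  dilate (a ∷ p) = a ∷ scaleX′ q (dilate p)

  coeff-dilate : ∀ p k → coeffX′ (dilate p) k ≋ qP^ k ⊗ coeffX′ p k
  coeff-dilate [] k = ≋-sym (ℤq.⊗-zeroʳ (qP^ k))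
  coeff-dilate (a ∷ p) zero = ≋-sym (ℤq.⊗-identityˡ a)
  coeff-dilate (a ∷ p) (suc k) = begin
    coeffX′ (scaleX′ q (dilate p)) k ≈⟨ ℤqx.coeff-scale q (dilate p) k ⟩
    q ⊗ coeffX′ (dilate p) k ≈⟨ ⊗-cong (≋-refl {q}) (coeff-dilate p k) ⟩
    q ⊗ (qP^ k ⊗ coeffX′ p k) ≈⟨ ≋-sym (ℤq.⊗-assoc q (qP^ k) (coeffX′ p k)) ⟩
    (q ⊗ qP^ k) ⊗ coeffX′ p k ≈⟨ ⊗-cong (≋-sym (qP^-suc k)) (≋-refl {coeffX′ p k}) ⟩
    qP^ (suc k) ⊗ coeffX′ p k ∎
    where open RZ

  dilate-cong : ∀ {p r} → p ≋X r → dilate p ≋X dilate r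
  dilate-cong {p} {r} e = mk≋X λ k → ≋-trans (coeff-dilate p k) (≋-trans (⊗-cong (≋-refl {qP^ k}) (getX e k)) (≋-sym (coeff-dilate r k)))

  dilate-⊕ : ∀ p r → dilate (p ⊕X r) ≋X dilate p ⊕X dilate r
  dilate-⊕ p r = mk≋X λ k → begin
    coeffX′ (dilate (p ⊕X r)) k ≈⟨ coeff-dilate (p ⊕X r) k ⟩
    qP^ k ⊗ coeffX′ (p ⊕X r) k ≈⟨ ⊗-cong (≋-refl {qP^ k}) (ℤqx.coeff-⊕ p r k) ⟩
    qP^ k ⊗ (coeffX′ p k ⊕ coeffX′ r k) ≈⟨ ℤq.⊗-distribˡ (qP^ k) (coeffX′ p k) (coeffX′ r k) ⟩
    qP^ k ⊗ coeffX′ p k ⊕ qP^ k ⊗ coeffX′ r k ≈⟨ ⊕-cong (≋-sym (coeff-dilate p k)) (≋-sym (coeff-dilate r k)) ⟩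
    coeffX′ (dilate p) k ⊕ coeffX′ (dilate r) k ≈⟨ ≋-sym (ℤqx.coeff-⊕ (dilate p) (dilate r) k) ⟩
    coeffX′ (dilate p ⊕X dilate r) k ∎
    where open RZ

  dilate-scale : ∀ c p → dilate (scaleX′ c p) ≋X scaleX′ c (dilate p)
  dilate-scale c p = mk≋X λ k → begin
    coeffX′ (dilate (scaleX′ c p)) k ≈⟨ coeff-dilate (scaleX′ c p) k ⟩
    qP^ k ⊗ coeffX′ (scaleX′ c p) k ≈⟨ ⊗-cong (≋-refl {qP^ k}) (ℤqx.coeff-scale c p k) ⟩
    qP^ k ⊗ (c ⊗ coeffX′ p k) ≈⟨ solve 3 (λ a b d → a :* (b :* d) ⊜ b :* (a :* d)) ≋-refl (qP^ k) c (coeffX′ p k) ⟩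
    c ⊗ (qP^ k ⊗ coeffX′ p k) ≈⟨ ⊗-cong (≋-refl {c}) (≋-sym (coeff-dilate p k)) ⟩
    c ⊗ coeffX′ (dilate p) k ≈⟨ ≋-sym (ℤqx.coeff-scale c (dilate p) k) ⟩
    coeffX′ (scaleX′ c (dilate p)) k ∎
    where open RZ

  dilate-⊗ : ∀ p r → dilate (p ⊗X r) ≋X dilate p ⊗X dilate r
  dilate-⊗ [] r = ≋X-refl
  dilate-⊗ (a ∷ p) r = begin
    dilate (scaleX′ a r ⊕X ([] ∷ p ⊗X r)) ≈⟨ dilate-⊕ (scaleX′ a r) ([] ∷ p ⊗X r) ⟩
    dilate (scaleX′ a r) ⊕X ([] ∷ scaleX′ q (dilate (p ⊗X r)))
      ≈⟨ ⊕X-cong (dilate-scale a r) (consX-cong (≋-refl {[]}) (ℤqx.scale-cong (≋-refl {q}) (dilate-⊗ p r))) ⟩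
    scaleX′ a (dilate r) ⊕X ([] ∷ scaleX′ q (dilate p ⊗X dilate r))
      ≈⟨ ⊕X-cong (≋X-refl {scaleX′ a (dilate r)}) (consX-cong (≋-refl {[]}) (≋X-sym (ℤqx.scale-⊗ q (dilate p) (dilate r)))) ⟩
    scaleX′ a (dilate r) ⊕X ([] ∷ scaleX′ q (dilate p) ⊗X dilate r) ∎
    where open RX

  poch′ : ℕ → PolyX
  poch′ zero = 1P ∷ []
  poch′ (suc i) = poch′ i ⊗X (1P ∷ ⊝ (qP^ i) ∷ [])

  negP≋⊝ : ∀ p → negP p ≋ ⊝ p
  negP≋⊝ p = ℤq.mk≋ λ i → Eq.trans (ℤq.coeff-scale (ℤ.- (+ 1)) p i)
    (Eq.trans (-1*i≡-i (ℤq.coeff p i)) (Eq.sym (ℤq.coeff-⊝ p i)))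

  poch≋poch′ : ∀ i → poch i ≋X poch′ i
  poch≋poch′ zero = ≋X-refl
  poch≋poch′ (suc i) = RX.begin
    poch i *X (1P ∷ negP (qP^ i) ∷ []) RX.≡⟨ *X≡⊗ (poch i) _ ⟩
    poch i ⊗X (1P ∷ negP (qP^ i) ∷ []) RX.≈⟨ ⊗X-cong (poch≋poch′ i) (consX-cong (≋-refl {1P}) (consX-cong (negP≋⊝ (qP^ i)) (≋X-refl {[]}))) ⟩
    poch′ (suc i) RX.∎

  pochQ : ℕ → PolyX
  pochQ zero = 1P ∷ []
  pochQ (suc i) = pochQ i ⊗X (1P ∷ ⊝ (qP^ (suc i)) ∷ [])

  dilate-poch′ : ∀ i → dilate (poch′ i) ≋X pochQ i
  dilate-poch′ zero = ≋X-refl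
  dilate-poch′ (suc i) = RX.begin
    dilate (poch′ i ⊗X (1P ∷ ⊝ (qP^ i) ∷ [])) RX.≈⟨ dilate-⊗ (poch′ i) _ ⟩
    dilate (poch′ i) ⊗X (1P ∷ (q ⊗ ⊝ (qP^ i)) ∷ []) RX.≈⟨ ⊗X-cong (dilate-poch′ i) (consX-cong (≋-refl {1P}) (consX-cong lem (≋X-refl {[]}))) ⟩
    pochQ (suc i) RX.∎
    where
    lem : q ⊗ ⊝ (qP^ i) ≋ ⊝ (qP^ (suc i))
    lem = ≋-trans (solve 2 (λ x Q → x :* (:- Q) ⊜ :- (x :* Q)) ≋-refl q (qP^ i)) (ℤq.⊝-cong (≋-sym (qP^-suc i)))

  1-X : PolyX
  1-X = 1P ∷ ⊝ 1P ∷ []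

  poch′-suc : ∀ i → poch′ (suc i) ≋X 1-X ⊗X pochQ i
  poch′-suc zero = ≋X-trans (ℤqx.⊗-identityˡ _) (≋X-sym (ℤqx.⊗-identityʳ 1-X))
  poch′-suc (suc i) = RX.begin
    poch′ (suc i) ⊗X L RX.≈⟨ ⊗X-cong (poch′-suc i) (≋X-refl {L}) ⟩
    (1-X ⊗X pochQ i) ⊗X L RX.≈⟨ ℤqx.⊗-assoc 1-X (pochQ i) L ⟩
    1-X ⊗X pochQ (suc i) RX.∎
    where L = 1P ∷ ⊝ (qP^ (suc i)) ∷ []

  qP^⊗poch′-suc : ∀ i → scaleX′ (qP^ (suc i)) (poch′ (suc i)) ≋X scaleX′ q^[1+ i ]-1 (pochQ i) ⊕X pochQ (suc i)
  qP^⊗poch′-suc i = RX.begin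
    scaleX′ Q (poch′ (suc i)) RX.≈⟨ ≋X-sym (ℤqx.const-⊗ Q (poch′ (suc i))) ⟩
    (Q ∷ []) ⊗X poch′ (suc i) RX.≈⟨ ⊗X-cong (≋X-refl {Q ∷ []}) (≋X-trans (poch′-suc i) (⊗X-cong (ℤqx.∷≋const+X⊗ 1P (⊝ 1P ∷ [])) (≋X-refl {pochQ i}))) ⟩
    (Q ∷ []) ⊗X (((1P ∷ []) ⊕X ℤqx.X ⊗X (⊝ 1P ∷ [])) ⊗X P)
      RX.≈⟨ ℤqx-Solver.solve 3 (λ x c p → c ∗ ((Κ one + x ∗ (− Κ one)) ∗ p) ≐ (c + − Κ one) ∗ p + p ∗ (Κ one + x ∗ (− c))) ≋X-refl ℤqx.X (Q ∷ []) P ⟩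
    ((Q ⊕ ⊝ 1P) ∷ []) ⊗X P ⊕X P ⊗X ((1P ∷ []) ⊕X ℤqx.X ⊗X (⊝ Q ∷ []))
      RX.≈⟨ ⊕X-cong (ℤqx.const-⊗ (Q ⊕ ⊝ 1P) P) (⊗X-cong (≋X-refl {P}) (≋X-sym (ℤqx.∷≋const+X⊗ 1P (⊝ Q ∷ [])))) ⟩
    scaleX′ (Q ⊕ ⊝ 1P) P ⊕X pochQ (suc i) RX.∎
    where
    open ℤqx-Solver using (Κ) renaming (_:+_ to _+_; _:*_ to _∗_; :-_ to −_; _⊜_ to _≐_)
    Q : Poly
    Q = qP^ (suc i)
    P : PolyX
    P = pochQ i
    one : PolyX
    one = 1P ∷ []

module HNumerator where

  open Coefficients
  open QNumbers
  open RookNumbers using (rookNumber; rookNumber-vanish-length; Decreasing)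
  open ColumnRemoval
  open Dilation
  open import Data.Nat as ℕ using (ℕ; zero; suc; _≤_; _<_; _∸_; z≤n; s≤s)
  import Data.Nat.Properties as NP
  open import Data.List using (List; []; length)
  open import Data.List.Relation.Unary.All using (All)
  open import Relation.Binary.PropositionalEquality as Eq using (_≡_)
  open ℤq using (_⊕_; _⊗_; ⊝; _≋_; ≋-refl; ≋-sym; ≋-trans; ⊕-cong; ⊗-cong)
  open ℤqx using () renaming (_⊕_ to _⊕X_; _≋_ to _≋X_;
    ≋-refl to ≋X-refl; ≋-sym to ≋X-sym; ≋-trans to ≋X-trans; ⊕-cong to ⊕X-cong;
    scale to scaleX′; coeff to coeffX′; ∑< to ∑<X)
  open ℤq-Solver using (solve; _⊜_; _:+_; _:*_; :-_)
  private
    module RZ = SetoidR ℤq.≋-setoid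
    module RX = SetoidR ℤqx.≋-setoid

  choose2≤ : ∀ m' i → i ≤ suc m' → choose2 i ≤ m' ℕ.* i
  choose2≤ m' zero _ = z≤n
  choose2≤ m' (suc i) (s≤s i≤m') = NP.≤-trans (NP.+-mono-≤ i≤m' (choose2≤ m' i (NP.m≤n⇒m≤1+n i≤m'))) (NP.≤-reflexive (Eq.sym (NP.*-suc m' i)))

  suc∸ : ∀ m' i → i ≤ m' → suc m' ∸ i ≡ suc (m' ∸ i)
  suc∸ m' i i≤m' = NP.+-∸-assoc 1 i≤m'

  exponent-shift : ∀ m' i → i ≤ suc m' → suc m' ℕ.* i ∸ choose2 i ≡ i ℕ.+ (m' ℕ.* i ∸ choose2 i)
  exponent-shift m' i le = NP.+-∸-assoc i (choose2≤ m' i le)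

  exponent-suc : ∀ m' i → i ≤ m' → m' ℕ.* suc i ∸ choose2 (suc i) ≡ (m' ℕ.* i ∸ choose2 i) ℕ.+ (m' ∸ i)
  exponent-suc m' i i≤m' = begin
    m' ℕ.* suc i ∸ (i ℕ.+ choose2 i) ≡⟨ Eq.cong (λ t → t ∸ (i ℕ.+ choose2 i)) (NP.*-suc m' i) ⟩
    (m' ℕ.+ m' ℕ.* i) ∸ (i ℕ.+ choose2 i) ≡⟨ Eq.sym (NP.∸-+-assoc (m' ℕ.+ m' ℕ.* i) i (choose2 i)) ⟩
    ((m' ℕ.+ m' ℕ.* i) ∸ i) ∸ choose2 i ≡⟨ Eq.cong (_∸ choose2 i) (NP.+-∸-comm (m' ℕ.* i) i≤m') ⟩
    ((m' ∸ i) ℕ.+ m' ℕ.* i) ∸ choose2 i ≡⟨ NP.+-∸-assoc (m' ∸ i) (choose2≤ m' i (NP.m≤n⇒m≤1+n i≤m')) ⟩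
    (m' ∸ i) ℕ.+ (m' ℕ.* i ∸ choose2 i) ≡⟨ NP.+-comm (m' ∸ i) _ ⟩
    (m' ℕ.* i ∸ choose2 i) ℕ.+ (m' ∸ i) ∎
    where open Eq.≡-Reasoning

  qSumX : ℕ → (ℕ → PolyX) → PolyX
  qSumX zero F = []
  qSumX (suc m) F = scaleX′ q (qSumX m F) ⊕X F (suc m)

  coeff-qSumX : ∀ m F k → coeffX′ (qSumX m F) k ≋ qSum m (λ j → coeffX′ (F j) k)
  coeff-qSumX zero F k = ≋-refl
  coeff-qSumX (suc m) F k = ≋-trans (ℤqx.coeff-⊕ (scaleX′ q (qSumX m F)) (F (suc m)) k)
    (⊕-cong (≋-trans (ℤqx.coeff-scale q (qSumX m F) k) (⊗-cong (≋-refl {q}) (coeff-qSumX m F k))) (≋-refl {coeffX′ (F (suc m)) k}))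

  scaleX-∑< : ∀ c N f → scaleX′ c (∑<X N f) ≋X ∑<X N (λ i → scaleX′ c (f i))
  scaleX-∑< c zero f = ≋X-refl
  scaleX-∑< c (suc N) f = ≋X-trans (ℤqx.scale-⊕ c (∑<X N f) (f N)) (⊕X-cong (scaleX-∑< c N f) (≋X-refl {scaleX′ c (f N)}))

  dilate-∑< : ∀ N f → dilate (∑<X N f) ≋X ∑<X N (λ i → dilate (f i))
  dilate-∑< zero f = ≋X-refl
  dilate-∑< (suc N) f = ≋X-trans (dilate-⊕ (∑<X N f) (f N)) (⊕X-cong (dilate-∑< N f) (≋X-refl {dilate (f N)}))

  qSumX-∑< : ∀ m N (a : ℕ → ℕ → Poly) (P : ℕ → PolyX) →
    qSumX m (λ j → ∑<X N (λ i → scaleX′ (a j i) (P i))) ≋X ∑<X N (λ i → scaleX′ (qSum m (λ j → a j i)) (P i))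
  qSumX-∑< zero N a P = ≋X-sym (ℤqx.≋-trans (ℤqx.∑<-cong N (λ i _ → ℤqx.scale-0 (P i))) (zeroΣ N))
    where
    zeroΣ : ∀ N → ∑<X N (λ _ → []) ≋X []
    zeroΣ zero = ≋X-refl
    zeroΣ (suc N) = ≋X-trans (ℤqx.⊕-identityʳ _) (zeroΣ N)
  qSumX-∑< (suc m) N a P = RX.begin
    scaleX′ q (qSumX m (λ j → ∑<X N (λ i → scaleX′ (a j i) (P i)))) ⊕X ∑<X N (λ i → scaleX′ (a (suc m) i) (P i))
      RX.≈⟨ ⊕X-cong (ℤqx.scale-cong (≋-refl {q}) (qSumX-∑< m N a P)) (≋X-refl {∑<X N (λ i → scaleX′ (a (suc m) i) (P i))}) ⟩
    scaleX′ q (∑<X N (λ i → scaleX′ (qSum m (λ j → a j i)) (P i))) ⊕X ∑<X N (λ i → scaleX′ (a (suc m) i) (P i))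
      RX.≈⟨ ⊕X-cong (scaleX-∑< q N (λ i → scaleX′ (qSum m (λ j → a j i)) (P i))) (≋X-refl {∑<X N (λ i → scaleX′ (a (suc m) i) (P i))}) ⟩
    ∑<X N (λ i → scaleX′ q (scaleX′ (qSum m (λ j → a j i)) (P i))) ⊕X ∑<X N (λ i → scaleX′ (a (suc m) i) (P i))
      RX.≈⟨ ≋X-sym (ℤqx.∑<-⊕ N (λ i → scaleX′ q (scaleX′ (qSum m (λ j → a j i)) (P i))) (λ i → scaleX′ (a (suc m) i) (P i))) ⟩
    ∑<X N (λ i → scaleX′ q (scaleX′ (qSum m (λ j → a j i)) (P i)) ⊕X scaleX′ (a (suc m) i) (P i))
      RX.≈⟨ ℤqx.∑<-cong N (λ i _ → ≋X-trans (⊕X-cong (ℤqx.scale-scale q (qSum m (λ j → a j i)) (P i)) (≋X-refl {scaleX′ (a (suc m) i) (P i)}))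
                                              (≋X-sym (ℤqx.scale-+ (q ⊗ qSum m (λ j → a j i)) (a (suc m) i) (P i)))) ⟩
    ∑<X N (λ i → scaleX′ (qSum (suc m) (λ j → a j i)) (P i)) RX.∎

  hTerm : ℕ → ℕ → List ℕ → Poly
  hTerm m i ls = ((rookNumber i ls ⊗ qfact (m ∸ i)) ⊗ signP i) ⊗ qP^ (m ℕ.* i ∸ choose2 i)

  hSum : ℕ → ℕ → List ℕ → PolyX
  hSum m n ls = ∑<X (suc n) (λ i → scaleX′ (hTerm m i ls) (poch′ i))

  qfact-suc : ∀ t → qfact (suc t) ≋ qint (suc t) ⊗ qfact t
  qfact-suc t = ℤq.≋-reflexive (*P≡⊗ (qint (suc t)) (qfact t))

  sign-suc : ∀ i → signP (suc i) ≋ ⊝ (signP i)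
  sign-suc i = negP≋⊝ (signP i)

  qfact-peel : ∀ m' i → i ≤ m' → qfact (suc m' ∸ i) ≋ qint (suc m' ∸ i) ⊗ qfact (m' ∸ i)
  qfact-peel m' i le = RZ.begin
    qfact (suc m' ∸ i) RZ.≡⟨ Eq.cong qfact (suc∸ m' i le) ⟩
    qfact (suc (m' ∸ i)) RZ.≈⟨ qfact-suc (m' ∸ i) ⟩
    qint (suc (m' ∸ i)) ⊗ qfact (m' ∸ i) RZ.≡⟨ Eq.cong (λ t → qint t ⊗ qfact (m' ∸ i)) (Eq.sym (suc∸ m' i le)) ⟩
    qint (suc m' ∸ i) ⊗ qfact (m' ∸ i) RZ.∎

  -- The summands regroup along i ↦ i + 1, which is how (qx;q)_i turns back into (x;q)_i.
  regroup : ∀ n (a b c : ℕ → PolyX) → c 0 ≋X a 0 → (∀ i → i < n → c (suc i) ≋X a (suc i) ⊕X b i) →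
            ∑<X n (λ i → a i ⊕X b i) ⊕X a n ≋X ∑<X (suc n) c
  regroup zero a b c c0 _ = ≋X-sym c0
  regroup (suc n) a b c c0 cs = RX.begin
    (∑<X n (λ i → a i ⊕X b i) ⊕X (a n ⊕X b n)) ⊕X a (suc n)
      RX.≈⟨ ℤqx-Solver.solve 4 (λ s x y z → (s + (x + y)) + z ≐ (s + x) + (z + y)) ≋X-refl (∑<X n (λ i → a i ⊕X b i)) (a n) (b n) (a (suc n)) ⟩
    (∑<X n (λ i → a i ⊕X b i) ⊕X a n) ⊕X (a (suc n) ⊕X b n)
      RX.≈⟨ ⊕X-cong (regroup n a b c c0 (λ i i<n → cs i (NP.m<n⇒m<1+n i<n))) (≋X-sym (cs n (NP.n<1+n n))) ⟩
    ∑<X (suc n) c ⊕X c (suc n) RX.∎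
    where open ℤqx-Solver using () renaming (_:+_ to _+_; _⊜_ to _≐_)

  -- hTerm′ i is hTerm (suc m') i without its factor q^i, which qP^⊗poch′-suc absorbs.
  module RemoveColumn (m' n : ℕ) (ls : List ℕ) (n≤m' : n ≤ m') (len : length ls ≡ n) where
    hFactor : ℕ → Poly
    hFactor i = (qfact (m' ∸ i) ⊗ signP i) ⊗ qP^ (m' ℕ.* i ∸ choose2 i)

    hTerm′ : ℕ → Poly
    hTerm′ i = ((rookNumber i ls ⊗ qfact (suc m' ∸ i)) ⊗ signP i) ⊗ qP^ (m' ℕ.* i ∸ choose2 i)

    summandQ : ℕ → PolyX
    summandQ i = scaleX′ (hTerm′ i) (pochQ i)
    summandQ′ : ℕ → PolyX
    summandQ′ i = scaleX′ (q^[1+ i ]-1 ⊗ hTerm′ (suc i)) (pochQ i)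

    removeColSum-hTerm : ∀ i → suc i ≤ n → hFactor i ⊗ removeColSum (suc m') i ls ≋ hTerm′ i ⊕ q^[1+ i ]-1 ⊗ hTerm′ (suc i)
    removeColSum-hTerm i lt = RZ.begin
      hFactor i ⊗ (qint (suc m' ∸ i) ⊗ R ⊕ ⊝ (qP^ (m' ∸ i) ⊗ (q^[1+ i ]-1 ⊗ R1)))
        RZ.≈⟨ solve 8 (λ F s QE I R R1 Qd E →
               ((F :* s) :* QE) :* (I :* R :+ :- (Qd :* (E :* R1)))
               ⊜ ((R :* (I :* F)) :* s) :* QE :+ E :* (((R1 :* F) :* (:- s)) :* (QE :* Qd)))
             ≋-refl (qfact (m' ∸ i)) (signP i) (qP^ (m' ℕ.* i ∸ choose2 i)) (qint (suc m' ∸ i)) R R1 (qP^ (m' ∸ i)) (q^[1+ i ]-1) ⟩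
      ((R ⊗ (qint (suc m' ∸ i) ⊗ qfact (m' ∸ i))) ⊗ signP i) ⊗ qP^ (m' ℕ.* i ∸ choose2 i)
        ⊕ q^[1+ i ]-1 ⊗ (((R1 ⊗ qfact (m' ∸ i)) ⊗ ⊝ (signP i)) ⊗ (qP^ (m' ℕ.* i ∸ choose2 i) ⊗ qP^ (m' ∸ i)))
        RZ.≈⟨ ⊕-cong (⊗-cong (⊗-cong (⊗-cong (≋-refl {R}) (≋-sym (qfact-peel m' i i≤m'))) (≋-refl {signP i})) (≋-refl {qP^ (m' ℕ.* i ∸ choose2 i)}))
                     (⊗-cong (≋-refl {q^[1+ i ]-1}) (⊗-cong (⊗-cong (≋-refl {R1 ⊗ qfact (m' ∸ i)}) (≋-sym (sign-suc i)))
                        (≋-sym (≋-trans (ℤq.≋-reflexive (Eq.cong qP^ (exponent-suc m' i i≤m'))) (qP^-+ (m' ℕ.* i ∸ choose2 i) (m' ∸ i)))))) ⟩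
      hTerm′ i ⊕ q^[1+ i ]-1 ⊗ hTerm′ (suc i) RZ.∎
      where
      R : Poly
      R = rookNumber i ls
      R1 : Poly
      R1 = rookNumber (suc i) ls
      i≤m' : i ≤ m'
      i≤m' = NP.≤-trans (NP.m≤n⇒m≤1+n NP.≤-refl) (NP.≤-trans lt n≤m')

    removeColSum-hTerm-top : hFactor n ⊗ removeColSum (suc m') n ls ≋ hTerm′ n
    removeColSum-hTerm-top = RZ.begin
      hFactor n ⊗ removeColSum (suc m') n ls RZ.≈⟨ ⊗-cong (≋-refl {hFactor n}) (removeColSum-vanish (suc m') n ls (rookNumber-vanish-length (suc n) ls (NP.≤-reflexive (Eq.cong suc len)))) ⟩
      hFactor n ⊗ (qint (suc m' ∸ n) ⊗ R)
        RZ.≈⟨ solve 5 (λ F s QE I R → ((F :* s) :* QE) :* (I :* R) ⊜ ((R :* (I :* F)) :* s) :* QE)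
              ≋-refl (qfact (m' ∸ n)) (signP n) (qP^ (m' ℕ.* n ∸ choose2 n)) (qint (suc m' ∸ n)) R ⟩
      ((R ⊗ (qint (suc m' ∸ n) ⊗ qfact (m' ∸ n))) ⊗ signP n) ⊗ qP^ (m' ℕ.* n ∸ choose2 n)
        RZ.≈⟨ ⊗-cong (⊗-cong (⊗-cong (≋-refl {R}) (≋-sym (qfact-peel m' n n≤m'))) (≋-refl {signP n})) (≋-refl {qP^ (m' ℕ.* n ∸ choose2 n)}) ⟩
      hTerm′ n RZ.∎
      where R = rookNumber n ls

    summand : ℕ → PolyX
    summand i = scaleX′ (hTerm (suc m') i ls) (poch′ i)

    hTerm-suc-split : ∀ i → suc i ≤ n → summand (suc i) ≋X summandQ (suc i) ⊕X summandQ′ i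
    hTerm-suc-split i lt = RX.begin
      scaleX′ (hTerm (suc m') (suc i) ls) (poch′ (suc i))
        RX.≈⟨ ℤqx.scale-cong hTerm-suc (≋X-refl {poch′ (suc i)}) ⟩
      scaleX′ (c ⊗ qP^ (suc i)) (poch′ (suc i)) RX.≈⟨ ≋X-sym (ℤqx.scale-scale c (qP^ (suc i)) (poch′ (suc i))) ⟩
      scaleX′ c (scaleX′ (qP^ (suc i)) (poch′ (suc i))) RX.≈⟨ ℤqx.scale-cong (≋-refl {c}) (qP^⊗poch′-suc i) ⟩
      scaleX′ c (scaleX′ (q^[1+ i ]-1) (pochQ i) ⊕X pochQ (suc i)) RX.≈⟨ ℤqx.scale-⊕ c (scaleX′ (q^[1+ i ]-1) (pochQ i)) (pochQ (suc i)) ⟩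
      scaleX′ c (scaleX′ (q^[1+ i ]-1) (pochQ i)) ⊕X summandQ (suc i) RX.≈⟨ ⊕X-cong (ℤqx.scale-scale c (q^[1+ i ]-1) (pochQ i)) (≋X-refl {summandQ (suc i)}) ⟩
      scaleX′ (c ⊗ q^[1+ i ]-1) (pochQ i) ⊕X summandQ (suc i) RX.≈⟨ ⊕X-cong (ℤqx.scale-cong (ℤq.⊗-comm c (q^[1+ i ]-1)) (≋X-refl {pochQ i})) (≋X-refl {summandQ (suc i)}) ⟩
      summandQ′ i ⊕X summandQ (suc i) RX.≈⟨ ℤqx.⊕-comm (summandQ′ i) (summandQ (suc i)) ⟩
      summandQ (suc i) ⊕X summandQ′ i RX.∎
      where
      c : Poly
      c = hTerm′ (suc i)
      le : suc i ≤ suc m'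
      le = NP.m≤n⇒m≤1+n (NP.≤-trans lt n≤m')
      hTerm-suc : hTerm (suc m') (suc i) ls ≋ c ⊗ qP^ (suc i)
      hTerm-suc = RZ.begin
        ((rookNumber (suc i) ls ⊗ qfact (suc m' ∸ suc i)) ⊗ signP (suc i)) ⊗ qP^ (suc m' ℕ.* suc i ∸ choose2 (suc i))
          RZ.≈⟨ ⊗-cong (≋-refl {(rookNumber (suc i) ls ⊗ qfact (suc m' ∸ suc i)) ⊗ signP (suc i)})
                 (≋-trans (ℤq.≋-reflexive (Eq.cong qP^ (exponent-shift m' (suc i) le))) (qP^-+ (suc i) (m' ℕ.* suc i ∸ choose2 (suc i)))) ⟩
        ((rookNumber (suc i) ls ⊗ qfact (suc m' ∸ suc i)) ⊗ signP (suc i)) ⊗ (qP^ (suc i) ⊗ qP^ (m' ℕ.* suc i ∸ choose2 (suc i)))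
          RZ.≈⟨ solve 3 (λ a Q E → a :* (Q :* E) ⊜ (a :* E) :* Q) ≋-refl
                 ((rookNumber (suc i) ls ⊗ qfact (suc m' ∸ suc i)) ⊗ signP (suc i)) (qP^ (suc i)) (qP^ (m' ℕ.* suc i ∸ choose2 (suc i))) ⟩
        c ⊗ qP^ (suc i) RZ.∎

    module _ (s : Decreasing ls) (bnd : All (_≤ suc m') ls) where
      qSum-hTerm-removeCol : ∀ i → qSum (suc m') (λ j → hTerm m' i (removeColList j ls)) ≋ hFactor i ⊗ removeColSum (suc m') i ls
      qSum-hTerm-removeCol i = ≋-trans (qSum-cong (suc m') (λ j _ _ → solve 4 (λ R f s Q → ((R :* f) :* s) :* Q ⊜ ((f :* s) :* Q) :* R) ≋-refl
                                     (rookNumber i (removeColList j ls)) (qfact (m' ∸ i)) (signP i) (qP^ (m' ℕ.* i ∸ choose2 i))))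
               (≋-trans (qSum-⊗ (suc m') (hFactor i) (λ j → rookNumber i (removeColList j ls))) (⊗-cong (≋-refl {hFactor i}) (qSum-removeCol ls (suc m') i s bnd)))

      dilate-qSumX-hSum-termwise :
        dilate (qSumX (suc m') (λ j → hSum m' n (removeColList j ls)))
        ≋X ∑<X n (λ i → summandQ i ⊕X summandQ′ i) ⊕X summandQ n
      dilate-qSumX-hSum-termwise = RX.begin
        dilate (qSumX (suc m') (λ j → hSum m' n (removeColList j ls)))
          RX.≈⟨ dilate-cong (qSumX-∑< (suc m') (suc n) (λ j i → hTerm m' i (removeColList j ls)) poch′) ⟩
        dilate (∑<X (suc n) (λ i → scaleX′ (W i) (poch′ i)))
          RX.≈⟨ dilate-∑< (suc n) (λ i → scaleX′ (W i) (poch′ i)) ⟩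
        ∑<X (suc n) (λ i → dilate (scaleX′ (W i) (poch′ i)))
          RX.≈⟨ ℤqx.∑<-cong (suc n) (λ i _ → ≋X-trans (dilate-scale (W i) (poch′ i)) (ℤqx.scale-cong (qSum-hTerm-removeCol i) (dilate-poch′ i))) ⟩
        ∑<X n (λ i → scaleX′ (hFactor i ⊗ removeColSum (suc m') i ls) (pochQ i)) ⊕X scaleX′ (hFactor n ⊗ removeColSum (suc m') n ls) (pochQ n)
          RX.≈⟨ ⊕X-cong (ℤqx.∑<-cong n (λ i lt → ≋X-trans (ℤqx.scale-cong (removeColSum-hTerm i lt) ≋X-refl) (ℤqx.scale-+ (hTerm′ i) (q^[1+ i ]-1 ⊗ hTerm′ (suc i)) (pochQ i))))
                        (ℤqx.scale-cong removeColSum-hTerm-top ≋X-refl) ⟩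
        ∑<X n (λ i → summandQ i ⊕X summandQ′ i) ⊕X summandQ n RX.∎
        where
        W : ℕ → Poly
        W i = qSum (suc m') (λ j → hTerm m' i (removeColList j ls))

      dilate-qSumX-hSum : dilate (qSumX (suc m') (λ j → hSum m' n (removeColList j ls))) ≋X hSum (suc m') n ls
      dilate-qSumX-hSum = ≋X-trans dilate-qSumX-hSum-termwise
        (regroup n summandQ summandQ′ summand ≋X-refl hTerm-suc-split)

module NonZeroDivisors where

  open Coefficients
  open QNumbers
  open HNumerator using (qfact-suc)
  open import Data.Nat using (zero; suc; _≤_; _≤?_)
  import Data.Nat.Properties as NP
  open import Data.Integer as ℤ using (+_)
  import Data.Integer.Properties as ℤP
  open import Data.List using ([]; _∷_)
  open import Relation.Nullary using (yes; no)
  open import Relation.Binary.PropositionalEquality as Eq using (_≡_; refl)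
  open ℤq using (_⊕_; _⊗_; ⊝; _≋_; ≋-refl; ≋-sym; ≋-trans; ⊕-cong; ⊗-cong)
  open ℤq-Solver using (solve; _⊜_; _:+_; _:*_; :-_)

  NonZeroDivisor : Poly → Set
  NonZeroDivisor d = ∀ a → a ⊗ d ≋ [] → a ≋ []

  NonZeroDivisor-cong : ∀ {d d'} → d ≋ d' → NonZeroDivisor d → NonZeroDivisor d'
  NonZeroDivisor-cong {d} {d'} e c a h = c a (≋-trans (⊗-cong (≋-refl {a}) e) h)

  NonZeroDivisor-⊗ : ∀ {d d'} → NonZeroDivisor d → NonZeroDivisor d' → NonZeroDivisor (d ⊗ d')
  NonZeroDivisor-⊗ {d} {d'} c c' a h = c a (c' (a ⊗ d) (≋-trans (ℤq.⊗-assoc a d d') h))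

  NonZeroDivisor-qP^ : ∀ e → NonZeroDivisor (qP^ e)
  NonZeroDivisor-qP^ zero a h = ≋-trans (≋-sym (ℤq.⊗-identityʳ a)) h
  NonZeroDivisor-qP^ (suc e) a h = NonZeroDivisor-qP^ e a (ℤq.≋[]-tail (≋-trans (ℤq.0∷≋X⊗ (a ⊗ qP^ e)) (≋-trans (ℤq.⊗-comm q (a ⊗ qP^ e))
     (≋-trans (ℤq.⊗-assoc a (qP^ e) q) (≋-trans (⊗-cong (≋-refl {a}) (≋-trans (ℤq.⊗-comm (qP^ e) q) (≋-sym (qP^-suc e)))) h)))))

  coeff-⊗-low : ∀ (p a : Poly) i → (∀ j → j ≤ i → ℤq.coeff a j ≡ + 0) → ℤq.coeff (p ⊗ a) i ≡ + 0
  coeff-⊗-low [] a i h = refl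
  coeff-⊗-low (b ∷ p) a i h = Eq.trans (ℤq.coeff-⊕ (ℤq.scale b a) (+ 0 ∷ p ⊗ a) i)
    (Eq.cong₂ ℤ._+_ (Eq.trans (ℤq.coeff-scale b a i) (Eq.trans (Eq.cong (b ℤ.*_) (h i NP.≤-refl)) (ℤP.*-zeroʳ b))) (tl i h))
    where
    tl : ∀ i → (∀ j → j ≤ i → ℤq.coeff a j ≡ + 0) → ℤq.coeff (+ 0 ∷ p ⊗ a) i ≡ + 0
    tl zero _ = refl
    tl (suc i) h' = coeff-⊗-low p a i (λ j j≤i → h' j (NP.m≤n⇒m≤1+n j≤i))

  -- The lowest nonzero coefficient of a would survive in a ⊗ (1 ∷ p).
  NonZeroDivisor-1∷ : ∀ p → NonZeroDivisor (+ 1 ∷ p)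
  NonZeroDivisor-1∷ p a h = ℤq.mk≋ λ j → P j j NP.≤-refl
    where
    h' : (+ 1 ∷ p) ⊗ a ≋ []
    h' = ≋-trans (ℤq.⊗-comm (+ 1 ∷ p) a) h
    eq : ∀ i → ℤq.coeff a i ℤ.+ ℤq.coeff (+ 0 ∷ p ⊗ a) i ≡ + 0
    eq i = Eq.trans (Eq.cong (ℤ._+ ℤq.coeff (+ 0 ∷ p ⊗ a) i) (Eq.sym (Eq.trans (ℤq.coeff-scale (+ 1) a i) (ℤP.*-identityˡ _))))
             (Eq.trans (Eq.sym (ℤq.coeff-⊕ (ℤq.scale (+ 1) a) (+ 0 ∷ p ⊗ a) i)) (ℤq.get h' i))
    P : ∀ i j → j ≤ i → ℤq.coeff a j ≡ + 0
    P zero zero _ = Eq.trans (Eq.sym (ℤP.+-identityʳ _)) (eq 0)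
    P (suc i) j j≤ with j ≤? i
    ... | yes j≤i = P i j j≤i
    ... | no j≰i with NP.≤-antisym j≤ (NP.≰⇒> j≰i)
    ...   | refl = Eq.trans (Eq.sym (ℤP.+-identityʳ _)) (Eq.trans (Eq.cong (λ t → ℤq.coeff a (suc i) ℤ.+ t) (Eq.sym (coeff-⊗-low p a i (P i)))) (eq (suc i)))

  NonZeroDivisor-qint : ∀ t → NonZeroDivisor (qint (suc t))
  NonZeroDivisor-qint t = NonZeroDivisor-1∷ (qint t)

  NonZeroDivisor-qfact : ∀ t → NonZeroDivisor (qfact t)
  NonZeroDivisor-qfact zero = NonZeroDivisor-1∷ []
  NonZeroDivisor-qfact (suc t) = NonZeroDivisor-cong (≋-sym (qfact-suc t)) (NonZeroDivisor-⊗ (NonZeroDivisor-qint t) (NonZeroDivisor-qfact t))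

  ⊗-cancelʳ : ∀ {d} → NonZeroDivisor d → ∀ a b → a ⊗ d ≋ b ⊗ d → a ≋ b
  ⊗-cancelʳ {d} c a b e = ≋-trans (≋-sym (solve 2 (λ a b → (a :+ :- b) :+ b ⊜ a) ≋-refl a b))
    (≋-trans (⊕-cong (c (a ⊕ ⊝ b) (≋-trans (solve 3 (λ a b d → (a :+ :- b) :* d ⊜ a :* d :+ :- (b :* d)) ≋-refl a b d)
                            (≋-trans (⊕-cong e (≋-refl {⊝ (b ⊗ d)})) (ℤq.⊝-inverseʳ (b ⊗ d))))) (≋-refl {b})) ≋-refl)

module FractionSums where

  open Coefficients
  open ListSums using (ΣL)
  open NonZeroDivisors using (NonZeroDivisor; ⊗-cancelʳ)
  open import Data.Nat using (ℕ)
  open import Data.List using (List; []; _∷_)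
  open import Data.List.Relation.Unary.All using (All; []; _∷_)
  open ℤq using (_⊕_; _⊗_; _≋_; ≋-refl; ≋-sym; ≋-trans; ⊕-cong; ⊗-cong)
  open ℤq-Solver using (solve; _⊜_; _:+_; _:*_)
  open SetoidR ℤq.≋-setoid

  *P≋ : ∀ p r → p *P r ≋ p ⊗ r
  *P≋ p r = ℤq.≋-reflexive (*P≡⊗ p r)

  +P≋ : ∀ p r → p +P r ≋ p ⊕ r
  +P≋ p r = ℤq.≋-reflexive (+P≡⊕ p r)

  sumF-cross : ∀ {A : Set} {Q : A → Set} (f : A → Frac) (g : A → Poly) D xs → All Q xs →
         (∀ {x} → Q x → num (f x) ⊗ D ≋ g x ⊗ den (f x)) →
         num (sumF (map f xs)) ⊗ D ≋ ΣL g xs ⊗ den (sumF (map f xs))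
  sumF-cross f g D [] [] h = ≋-sym (ℤq.⊗-identityʳ [])
  sumF-cross f g D (x ∷ xs) (px ∷ pxs) h = begin
    (num (f x) *P dS +P nS *P den (f x)) ⊗ D
      ≈⟨ ⊗-cong (≋-trans (+P≋ (num (f x) *P dS) (nS *P den (f x))) (⊕-cong (*P≋ (num (f x)) dS) (*P≋ nS (den (f x))))) (≋-refl {D}) ⟩
    (num (f x) ⊗ dS ⊕ nS ⊗ den (f x)) ⊗ D
      ≈⟨ solve 5 (λ a b c e D → (a :* b :+ c :* e) :* D ⊜ (a :* D) :* b :+ (c :* D) :* e) ≋-refl (num (f x)) dS nS (den (f x)) D ⟩
    (num (f x) ⊗ D) ⊗ dS ⊕ (nS ⊗ D) ⊗ den (f x)
      ≈⟨ ⊕-cong (⊗-cong (h px) (≋-refl {dS})) (⊗-cong (sumF-cross f g D xs pxs h) (≋-refl {den (f x)})) ⟩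
    (g x ⊗ den (f x)) ⊗ dS ⊕ (ΣL g xs ⊗ dS) ⊗ den (f x)
      ≈⟨ solve 4 (λ a b c e → (a :* b) :* c :+ (e :* c) :* b ⊜ (a :+ e) :* (b :* c)) ≋-refl (g x) (den (f x)) dS (ΣL g xs) ⟩
    (g x ⊕ ΣL g xs) ⊗ (den (f x) ⊗ dS) ≈⟨ ⊗-cong (≋-refl {g x ⊕ ΣL g xs}) (≋-sym (*P≋ (den (f x)) dS)) ⟩
    (g x ⊕ ΣL g xs) ⊗ (den (f x) *P dS) ∎
    where
    S : Frac
    S = sumF (map f xs)
    nS : Poly
    nS = num S
    dS : Poly
    dS = den S

  num-sumF-*0F : ∀ (a : ℕ → Frac) xs → num (sumF (map (λ j → a j *F 0F) xs)) ≋ []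
  num-sumF-*0F a [] = ≋-refl
  num-sumF-*0F a (x ∷ xs) = ≋-trans (+P≋ (num ax *P den S) (num S *P den ax)) (⊕-cong
    (≋-trans (*P≋ (num ax) (den S)) (ℤq.⊗-[]ˡ (num ax) (den S) (≋-trans (*P≋ (num (a x)) []) (ℤq.⊗-zeroʳ (num (a x))))))
    (≋-trans (*P≋ (num S) (den ax)) (ℤq.⊗-[]ˡ (num S) (den ax) (num-sumF-*0F a xs))))
    where
    ax : Frac
    ax = a x *F 0F
    S : Frac
    S = sumF (map (λ j → a j *F 0F) xs)

  sumF-*0F : ∀ (a : ℕ → Frac) xs (X : Frac) → sumF (map (λ j → a j *F 0F) xs) ≈F (X *F 0F)
  sumF-*0F a xs X = ≋⇒≈P (≋-trans (*P≋ (num L) (den (X *F 0F)))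
    (≋-trans (ℤq.⊗-[]ˡ _ (den (X *F 0F)) (num-sumF-*0F a xs))
    (≋-sym (≋-trans (*P≋ (num (X *F 0F)) (den L)) (ℤq.⊗-[]ˡ _ (den L) (≋-trans (*P≋ (num X) []) (ℤq.⊗-zeroʳ (num X))))))))
    where L = sumF (map (λ j → a j *F 0F) xs)

  ≈F-via-common-factor : ∀ {L R} D G → NonZeroDivisor D →
    num L ⊗ D ≋ G ⊗ den L → G ⊗ den R ≋ num R ⊗ D → L ≈F R
  ≈F-via-common-factor {L} {R} D G nzd l r =
    ≋⇒≈P (≋-trans (*P≋ (num L) (den R)) (≋-trans (⊗-cancelʳ nzd (num L ⊗ den R) (num R ⊗ den L) chain) (≋-sym (*P≋ (num R) (den L)))))
    where
    swap : ∀ a b c → (a ⊗ b) ⊗ c ≋ (a ⊗ c) ⊗ b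
    swap = solve 3 (λ a b c → (a :* b) :* c ⊜ (a :* c) :* b) ≋-refl
    chain : (num L ⊗ den R) ⊗ D ≋ (num R ⊗ den L) ⊗ D
    chain = begin
      (num L ⊗ den R) ⊗ D ≈⟨ swap (num L) (den R) D ⟩
      (num L ⊗ D) ⊗ den R ≈⟨ ⊗-cong l ≋-refl ⟩
      (G ⊗ den L) ⊗ den R ≈⟨ swap G (den L) (den R) ⟩
      (G ⊗ den R) ⊗ den L ≈⟨ ⊗-cong r ≋-refl ⟩
      (num R ⊗ D) ⊗ den L ≈⟨ swap (num R) D (den L) ⟩
      (num R ⊗ den L) ⊗ D ∎

module Boards where

  open Coefficients
  open FilterCounts using (filterᵇ-cons)
  open RookNumbers using (Decreasing; []; _∷_; rookPoly≋rookNumber)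
  open ColumnRemoval using (shortenRow; removeColList)
  open Dilation using (poch≋poch′)
  open HNumerator using (hTerm; hSum)
  open import Data.Nat as ℕ using (ℕ; zero; suc; _≤_; _≤ᵇ_; z≤n; s≤s)
  import Data.Nat.Properties as NP
  open import Data.Bool using (true; false; T)
  open import Data.Empty using (⊥-elim)
  open import Data.List using (List; []; _∷_; applyUpTo; foldr; length; filterᵇ)
  import Data.List.Properties as LP
  open import Data.List.Relation.Unary.All as All using (All; []; _∷_)
  import Data.List.Relation.Unary.All.Properties as AllP
  open import Data.Vec as Vec using (toList; lookup)
  open import Data.Fin as Fin using (Fin)
  open import Relation.Binary.PropositionalEquality as Eq using (_≡_; refl)
  open ℤq using (_≋_; ≋-refl; ⊗-cong)
  open ℤqx using () renaming (_≋_ to _≋X_; ≋-refl to ≋X-refl; ≋-sym to ≋X-sym;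
    ≋-trans to ≋X-trans; ⊕-cong to ⊕X-cong; ∑< to ∑<X)

  All-toList : ∀ {n} {P : ℕ → Set} (xs : Vec ℕ n) → (∀ i → P (lookup xs i)) → All P (toList xs)
  All-toList Vec.[] h = []
  All-toList (x Vec.∷ xs) h = h Fin.zero ∷ All-toList xs (λ i → h (Fin.suc i))

  decreasing-toList : ∀ {n} (lam : Vec ℕ n) → (∀ (i j : Fin n) → i Fin.≤ j → lookup lam j ≤ lookup lam i) → Decreasing (toList lam)
  decreasing-toList Vec.[] h = []
  decreasing-toList (x Vec.∷ xs) h = All-toList xs (λ j → h Fin.zero (Fin.suc j) z≤n) ∷ decreasing-toList xs (λ i j i≤j → h (Fin.suc i) (Fin.suc j) (s≤s i≤j))

  shortenRow-mono : ∀ j {x y} → x ≤ y → shortenRow j x ≤ shortenRow j y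
  shortenRow-mono j {x} {y} x≤y with j ≤ᵇ x in ex | j ≤ᵇ y in ey
  ... | true | true = NP.∸-monoˡ-≤ 1 x≤y
  ... | false | false = x≤y
  ... | true | false = ⊥-elim (NP.<⇒≱ (NP.≰⇒> (λ j≤y → Eq.subst T ey (NP.≤⇒≤ᵇ j≤y))) (NP.≤-trans (NP.≤ᵇ⇒≤ j x (Eq.subst T (Eq.sym ex) _)) x≤y))
  ... | false | true = NP.≤-pred (NP.≤-trans (NP.≰⇒> (λ j≤x → Eq.subst T ex (NP.≤⇒≤ᵇ j≤x))) (NP.≤-trans (NP.≤ᵇ⇒≤ j y (Eq.subst T (Eq.sym ey) _)) (NP.≤-reflexive (Eq.sym (NP.suc-pred y {{nz}})))))
    where
    nz : ℕ.NonZero y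
    nz = ℕ.≢-nonZero λ { refl → Eq.subst T ex (NP.≤⇒≤ᵇ (NP.≤-trans (NP.≤ᵇ⇒≤ j 0 (Eq.subst T (Eq.sym ey) _)) z≤n)) }

  removeColList-decreasing : ∀ j ls → Decreasing ls → Decreasing (removeColList j ls)
  removeColList-decreasing j [] [] = []
  removeColList-decreasing j (l ∷ ls) (a ∷ s) = AllP.map⁺ (All.map (shortenRow-mono j) a) ∷ removeColList-decreasing j ls s

  sizeL : List ℕ → ℕ
  sizeL = foldr ℕ._+_ 0

  conjL : ℕ → List ℕ → ℕ
  conjL j ls = length (filterᵇ (λ l → j ≤ᵇ l) ls)

  size-removeColList : ∀ j ls → 1 ≤ j → sizeL (removeColList j ls) ℕ.+ conjL j ls ≡ sizeL ls
  size-removeColList j [] _ = refl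
  size-removeColList j (l ∷ ls) 1≤j rewrite filterᵇ-cons (λ l → j ≤ᵇ l) l ls with j ≤ᵇ l in e
  ... | true = Eq.trans (NP.+-suc (l ∸ 1 ℕ.+ sizeL (removeColList j ls)) (conjL j ls))
     (Eq.trans (Eq.cong suc (NP.+-assoc (l ∸ 1) (sizeL (removeColList j ls)) (conjL j ls)))
     (Eq.trans (Eq.cong (λ t → suc (l ∸ 1 ℕ.+ t)) (size-removeColList j ls 1≤j))
     (Eq.cong (ℕ._+ sizeL ls) (NP.suc-pred l {{nz}}))))
    where
    nz : ℕ.NonZero l
    nz = ℕ.>-nonZero (NP.≤-trans 1≤j (NP.≤ᵇ⇒≤ j l (Eq.subst T (Eq.sym e) _)))
  ... | false = Eq.trans (NP.+-assoc l (sizeL (removeColList j ls)) (conjL j ls)) (Eq.cong (l ℕ.+_) (size-removeColList j ls 1≤j))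

  conjL≤length : ∀ j ls → conjL j ls ≤ length ls
  conjL≤length j ls = LP.length-filter _ ls

  sumX≋∑< : ∀ N f → sumX (applyUpTo f N) ≋X ∑<X N f
  sumX≋∑< zero f = ≋X-refl
  sumX≋∑< (suc N) f = ≋X-trans (ℤqx.≋-reflexive (+X≡⊕ (f 0) (sumX (applyUpTo (λ i → f (suc i)) N))))
    (≋X-trans (⊕X-cong (≋X-refl {f 0}) (sumX≋∑< N (λ i → f (suc i)))) (≋X-sym (ℤqx.∑<-suc N f)))

  HSum≋hSum : ∀ m n (lam : Vec ℕ n) → Decreasing (toList lam) → HSum m n lam ≋X hSum m n (toList lam)
  HSum≋hSum m n lam s = ≋X-trans (ℤqx.≋-reflexive (Eq.cong sumX (LP.map-upTo F (suc n))))
    (≋X-trans (sumX≋∑< (suc n) F) (ℤqx.∑<-cong (suc n) (λ i _ → ≋X-trans (ℤqx.≋-reflexive (scaleX≡scale (rookPoly i lam *P qfact (m ∸ i) *P signP i *P qP^ (m ℕ.* i ∸ choose2 i)) (poch i))) (ℤqx.scale-cong (ceq i) (poch≋poch′ i)))))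
    where
    F : ℕ → PolyX
    F = λ i → scaleX (rookPoly i lam *P qfact (m ∸ i) *P signP i *P qP^ (m ℕ.* i ∸ choose2 i)) (poch i)
    ceq : ∀ i → rookPoly i lam *P qfact (m ∸ i) *P signP i *P qP^ (m ℕ.* i ∸ choose2 i) ≋ hTerm m i (toList lam)
    ceq i rewrite *P≡⊗ (rookPoly i lam *P qfact (m ∸ i) *P signP i) (qP^ (m ℕ.* i ∸ choose2 i))
                | *P≡⊗ (rookPoly i lam *P qfact (m ∸ i)) (signP i)
                | *P≡⊗ (rookPoly i lam) (qfact (m ∸ i)) =
      ⊗-cong (⊗-cong (⊗-cong (rookPoly≋rookNumber i lam s) (≋-refl {qfact (m ∸ i)})) (≋-refl {signP i})) (≋-refl {qP^ (m ℕ.* i ∸ choose2 i)})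

-- The case 0 ≤ k = i ≤ n, with m = m' + 1. As |λ^c_j| = |λ| - λ'_j, the j-th summand
-- is q^(m+n-j) C_j / D with C_j the x^i-coefficient of the numerator of H(λ^c_j)
-- and D = q^|λ| [m' - n]!; both sides are compared after multiplying by D.
module CoefficientInRange (m' n : ℕ) (n≤m' : n ≤ m') (lam : Vec ℕ n) (P : IsPartitionIn n (suc m') lam) (i : ℕ) (i≤n : i ≤ n) where
  open Coefficients
  open QNumbers
  open FilterCounts using (upTo-<)
  open ListSums using (ΣL; ΣL-cong; ΣL-⊗)
  open RookNumbers using (Decreasing)
  open ColumnRemoval using (shortenRow; removeColList; qSum; qSum-cong; ΣL≋qSum)
  open Dilation using (dilate; coeff-dilate)
  open HNumerator
  open NonZeroDivisors
  open FractionSums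
  open Boards
  open import Data.Nat as ℕ using (ℕ; suc; _≤_; z≤n; s≤s)
  import Data.Nat.Properties as NP
  open import Data.Integer as ℤ using (ℤ; +_)
  import Data.Integer.Properties as ℤP
  open import Data.List using (List; length)
  open import Data.List.Relation.Unary.All as All using (All)
  import Data.List.Relation.Unary.All.Properties as AllP
  open import Data.Vec using (toList)
  import Data.Vec.Properties as VP
  open import Data.Product using (_×_; _,_; proj₁; proj₂)
  open import Relation.Binary.PropositionalEquality as Eq using (_≡_)
  open ℤq using (_⊗_; _≋_; ≋-refl; ≋-sym; ≋-trans; ⊗-cong)
  open ℤqx using () renaming (coeff to coeffX′)
  open ℤq-Solver using (solve; _⊜_; _:*_; Κ)
  open SetoidR ℤq.≋-setoid

  +-+≡+∸ : ∀ a b → b ≤ a → + a ℤ.- + b ≡ + (a ∸ b)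
  +-+≡+∸ a b le = Eq.trans (ℤP.m-n≡m⊖n a b) (ℤP.⊖-≥ le)

  ls : List ℕ
  ls = toList lam
  s : Decreasing ls
  s = decreasing-toList lam (proj₁ P)
  bnd : All (_≤ suc m') ls
  bnd = All-toList lam (proj₂ P)
  len : length ls ≡ n
  len = VP.length-toList lam

  toList-removeCol : ∀ j → toList (removeCol j lam) ≡ removeColList j ls
  toList-removeCol j = VP.toList-map (shortenRow j) lam

  Cj : ℕ → Poly
  Cj j = coeffX (HSum m' n (removeCol j lam)) i

  Hfj : ℕ → Frac
  Hfj j = Cj j / (qP^ (size (removeCol j lam)) *P qfact (m' ∸ n))

  Ej : ℕ → ℤ
  Ej j = + suc m' ℤ.+ + n ℤ.- + j ℤ.- + conj lam j

  f : ℕ → Frac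
  f j = qF^ (Ej j) *F Hfj j

  Mj : ℕ → ℕ
  Mj j = suc m' ℕ.+ n ∸ j
  ej : ℕ → ℕ
  ej j = Mj j ∸ conj lam j

  S : ℕ
  S = size lam
  Fm : Poly
  Fm = qfact (m' ∸ n)
  D : Poly
  D = qP^ S ⊗ Fm

  g : ℕ → Poly
  g j = qP^ (Mj j) ⊗ Cj j

  Q : ℕ → Set
  Q j = (1 ≤ j) × (j ≤ suc m')

  Qall : All Q (map suc (upTo (suc m')))
  Qall = AllP.map⁺ (All.map (λ c<m → s≤s z≤n , c<m) (upTo-< (suc m')))

  conj≤exponent : ∀ j → j ≤ suc m' → conj lam j ≤ Mj j
  conj≤exponent j j≤ = NP.≤-trans (NP.≤-trans (conjL≤length j ls) (NP.≤-reflexive len))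
    (NP.≤-trans (NP.m≤n+m n (suc m' ∸ j)) (NP.≤-reflexive (Eq.sym (NP.+-∸-comm n j≤))))

  exponent≡ : ∀ j → j ≤ suc m' → Ej j ≡ + ej j
  exponent≡ j j≤ = Eq.trans (Eq.cong (ℤ._- + conj lam j) (+-+≡+∸ (suc m' ℕ.+ n) j (NP.≤-trans j≤ (NP.m≤m+n (suc m') n))))
                      (+-+≡+∸ (Mj j) (conj lam j) (conj≤exponent j j≤))

  summand-cleared : ∀ {j} → Q j → num (f j) ⊗ D ≋ g j ⊗ den (f j)
  summand-cleared {j} (1≤j , j≤) = begin
    (num (qF^ (Ej j)) *P Cj j) ⊗ D
      ≈⟨ ⊗-cong (≋-trans (*P≋ (num (qF^ (Ej j))) (Cj j)) (⊗-cong (ℤq.≋-reflexive (Eq.cong (λ z → num (qF^ z)) (exponent≡ j j≤))) (≋-refl {Cj j}))) (≋-refl {D}) ⟩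
    (qP^ (ej j) ⊗ Cj j) ⊗ (qP^ S ⊗ Fm)
      ≈⟨ ⊗-cong (≋-refl {qP^ (ej j) ⊗ Cj j}) (⊗-cong (≋-trans (ℤq.≋-reflexive (Eq.cong qP^ Seq)) (qP^-+ Sj (conj lam j))) (≋-refl {Fm})) ⟩
    (qP^ (ej j) ⊗ Cj j) ⊗ ((qP^ Sj ⊗ qP^ (conj lam j)) ⊗ Fm)
      ≈⟨ solve 5 (λ E C Sj c F → (E :* C) :* ((Sj :* c) :* F) ⊜ ((E :* c) :* C) :* (Κ 1P :* (Sj :* F)))
            ≋-refl (qP^ (ej j)) (Cj j) (qP^ Sj) (qP^ (conj lam j)) Fm ⟩
    ((qP^ (ej j) ⊗ qP^ (conj lam j)) ⊗ Cj j) ⊗ (1P ⊗ (qP^ Sj ⊗ Fm))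
      ≈⟨ ⊗-cong (⊗-cong (≋-trans (≋-sym (qP^-+ (ej j) (conj lam j))) (ℤq.≋-reflexive (Eq.cong qP^ (NP.m∸n+n≡m (conj≤exponent j j≤))))) (≋-refl {Cj j}))
                (≋-sym (≋-trans (*P≋ (den (qF^ (Ej j))) (qP^ Sj' *P Fm))
                   (⊗-cong (ℤq.≋-reflexive (Eq.cong (λ z → den (qF^ z)) (exponent≡ j j≤)))
                      (≋-trans (*P≋ (qP^ Sj') Fm) (⊗-cong (ℤq.≋-reflexive (Eq.cong qP^ (Eq.cong sizeL (toList-removeCol j)))) (≋-refl {Fm})))))) ⟩
    g j ⊗ den (f j) ∎
    where
    Sj' : ℕ
    Sj' = size (removeCol j lam)
    Sj : ℕ
    Sj = sizeL (removeColList j ls)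
    Seq : S ≡ Sj ℕ.+ conj lam j
    Seq = Eq.sym (size-removeColList j ls 1≤j)

  L : Frac
  L = sumF (map f (map suc (upTo (suc m'))))

  lhs-cleared : num L ⊗ D ≋ ΣL g (map suc (upTo (suc m'))) ⊗ den L
  lhs-cleared = sumF-cross f g D (map suc (upTo (suc m'))) Qall summand-cleared

  W : Poly
  W = qSum (suc m') Cj
  Hc : Poly
  Hc = coeffX (HSum (suc m') n lam) i

  ΣL≋qⁿ⊗qSum : ΣL g (map suc (upTo (suc m'))) ≋ qP^ n ⊗ W
  ΣL≋qⁿ⊗qSum = ≋-trans (ΣL-cong Qall (λ {j} (_ , j≤) → tm j j≤))
         (≋-trans (ΣL-⊗ (qP^ n) (λ j → qP^ (suc m' ∸ j) ⊗ Cj j) (map suc (upTo (suc m'))))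
                  (⊗-cong (≋-refl {qP^ n}) (ΣL≋qSum (suc m') Cj)))
    where
    tm : ∀ j → j ≤ suc m' → g j ≋ qP^ n ⊗ (qP^ (suc m' ∸ j) ⊗ Cj j)
    tm j j≤ = ≋-trans (⊗-cong (≋-trans (ℤq.≋-reflexive (Eq.cong qP^ (Eq.trans (NP.+-∸-comm n j≤) (NP.+-comm (suc m' ∸ j) n))))
                                         (qP^-+ n (suc m' ∸ j))) (≋-refl {Cj j}))
                      (ℤq.⊗-assoc (qP^ n) (qP^ (suc m' ∸ j)) (Cj j))

  qⁱ⊗qSum≋coeff : qP^ i ⊗ W ≋ Hc
  qⁱ⊗qSum≋coeff = begin
    qP^ i ⊗ W ≈⟨ ⊗-cong (≋-refl {qP^ i}) (qSum-cong (suc m') (λ j _ _ → cjeq j)) ⟩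
    qP^ i ⊗ qSum (suc m') (λ j → coeffX′ (hSum m' n (removeColList j ls)) i) ≈⟨ ⊗-cong (≋-refl {qP^ i}) (≋-sym (coeff-qSumX (suc m') (λ j → hSum m' n (removeColList j ls)) i)) ⟩
    qP^ i ⊗ coeffX′ (qSumX (suc m') (λ j → hSum m' n (removeColList j ls))) i ≈⟨ ≋-sym (coeff-dilate (qSumX (suc m') (λ j → hSum m' n (removeColList j ls))) i) ⟩
    coeffX′ (dilate (qSumX (suc m') (λ j → hSum m' n (removeColList j ls)))) i ≈⟨ ℤqx.get (RemoveColumn.dilate-qSumX-hSum m' n ls n≤m' len s bnd) i ⟩
    coeffX′ (hSum (suc m') n ls) i ≈⟨ ≋-sym (ℤqx.get (HSum≋hSum (suc m') n lam s) i) ⟩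
    coeffX′ (HSum (suc m') n lam) i ≡⟨ Eq.sym (coeffX≡coeff (HSum (suc m') n lam) i) ⟩
    Hc ∎
    where
    cjeq : ∀ j → Cj j ≋ coeffX′ (hSum m' n (removeColList j ls)) i
    cjeq j = ≋-trans (ℤq.≋-reflexive (coeffX≡coeff (HSum m' n (removeCol j lam)) i))
      (≋-trans (ℤqx.get (HSum≋hSum m' n (removeCol j lam) (Eq.subst Decreasing (Eq.sym (toList-removeCol j)) (removeColList-decreasing j ls s))) i)
               (ℤq.≋-reflexive (Eq.cong (λ z → coeffX′ (hSum m' n z) i) (toList-removeCol j))))

  Hm : Frac
  Hm = Hc / (qP^ S *P qfact (suc m' ∸ n))

  R : Frac
  R = fromP (qint (suc m' ∸ n)) *F qF^ (+ n ℤ.- + i) *F Hm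

  ni : + n ℤ.- + i ≡ + (n ∸ i)
  ni = +-+≡+∸ n i i≤n

  numR : num R ≋ (qint (suc m' ∸ n) ⊗ qP^ (n ∸ i)) ⊗ Hc
  numR = ≋-trans (*P≋ (qint (suc m' ∸ n) *P num (qF^ (+ n ℤ.- + i))) Hc) (⊗-cong (≋-trans (*P≋ (qint (suc m' ∸ n)) (num (qF^ (+ n ℤ.- + i)))) (⊗-cong (≋-refl {qint (suc m' ∸ n)}) (ℤq.≋-reflexive (Eq.cong (λ z → num (qF^ z)) ni)))) (≋-refl {Hc}))

  denR : den R ≋ (1P ⊗ 1P) ⊗ (qP^ S ⊗ (qint (suc m' ∸ n) ⊗ Fm))
  denR = ≋-trans (*P≋ (1P *P den (qF^ (+ n ℤ.- + i))) (qP^ S *P qfact (suc m' ∸ n))) (⊗-cong (≋-trans (*P≋ 1P (den (qF^ (+ n ℤ.- + i)))) (⊗-cong (≋-refl {1P}) (ℤq.≋-reflexive (Eq.cong (λ z → den (qF^ z)) ni))))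
                                   (≋-trans (*P≋ (qP^ S) (qfact (suc m' ∸ n))) (⊗-cong (≋-refl {qP^ S}) (qfact-peel m' n n≤m'))))

  rhs-cleared : (qP^ n ⊗ W) ⊗ den R ≋ num R ⊗ D
  rhs-cleared = begin
    (qP^ n ⊗ W) ⊗ den R ≈⟨ ⊗-cong (⊗-cong (≋-trans (ℤq.≋-reflexive (Eq.cong qP^ (Eq.sym (NP.m∸n+n≡m i≤n)))) (qP^-+ (n ∸ i) i)) (≋-refl {W})) denR ⟩
    ((qP^ (n ∸ i) ⊗ qP^ i) ⊗ W) ⊗ ((1P ⊗ 1P) ⊗ (qP^ S ⊗ (qint (suc m' ∸ n) ⊗ Fm)))
      ≈⟨ solve 6 (λ Qn Qi W Qs I F → ((Qn :* Qi) :* W) :* ((Κ 1P :* Κ 1P) :* (Qs :* (I :* F)))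
                       ⊜ ((I :* Qn) :* (Qi :* W)) :* (Qs :* F))
          ≋-refl (qP^ (n ∸ i)) (qP^ i) W (qP^ S) (qint (suc m' ∸ n)) Fm ⟩
    ((qint (suc m' ∸ n) ⊗ qP^ (n ∸ i)) ⊗ (qP^ i ⊗ W)) ⊗ D ≈⟨ ⊗-cong (⊗-cong (≋-refl {qint (suc m' ∸ n) ⊗ qP^ (n ∸ i)}) qⁱ⊗qSum≋coeff) (≋-refl {D}) ⟩
    ((qint (suc m' ∸ n) ⊗ qP^ (n ∸ i)) ⊗ Hc) ⊗ D ≈⟨ ⊗-cong (≋-sym numR) (≋-refl {D}) ⟩
    num R ⊗ D ∎

  result : L ≈F R
  result = ≈F-via-common-factor {L} {R} D (qP^ n ⊗ W)
    (NonZeroDivisor-⊗ (NonZeroDivisor-qP^ S) (NonZeroDivisor-qfact (m' ∸ n)))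
    (≋-trans lhs-cleared (⊗-cong ΣL≋qⁿ⊗qSum ≋-refl)) rhs-cleared

open FractionSums using (sumF-*0F)
open import Data.Nat using (s≤s; _≤?_)
open import Data.Integer using (-[1+_])
open import Relation.Nullary using (yes; no)

lemma3p6 : (m n : ℕ) → n < m → (lam : Vec ℕ n) → IsPartitionIn n m lam → (k : ℤ) →
    sumF (map (λ j → qF^ (+ m Data.Integer.+ + n - + j - + conj lam j)
                       *F H (m ∸ 1) n (removeCol j lam) k)
              (map suc (upTo m)))
    ≈F (fromP (qint (m ∸ n)) *F qF^ (+ n - k) *F H m n lam k)
lemma3p6 (suc m') n (s≤s n≤m') lam P -[1+ x ] =
  sumF-*0F (λ j → qF^ (+ suc m' Data.Integer.+ + n - + j - + conj lam j)) (map suc (upTo (suc m')))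
    (fromP (qint (suc m' ∸ n)) *F qF^ (+ n - -[1+ x ]))
lemma3p6 (suc m') n (s≤s n≤m') lam P (+ i) with i ≤? n
... | yes i≤n = CoefficientInRange.result m' n n≤m' lam P i i≤n
... | no _ = sumF-*0F (λ j → qF^ (+ suc m' Data.Integer.+ + n - + j - + conj lam j)) (map suc (upTo (suc m')))
               (fromP (qint (suc m' ∸ n)) *F qF^ (+ n - + i))
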